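{- Let $\alpha\in\mathbb{N}_0^N$ with $N=\ell(\alpha)+|\alpha|$, $\upsilon=\frac1{N+1}$, $\widetilde{\alpha}_i=\alpha_i-i\upsilon$, and $w$ the permutation of $\{1,\ldots,N\}$ with $r(\alpha,w(i))=i$. Fix an integer $n$ with $1\le n\le\alpha_{w(1)}$, let $m:=L(\alpha;w(1),\alpha_{w(1)}+1-n)+1$, put $\xi_{mk+i}:=\widetilde{\alpha}_{w(i)}-nk$ ($1\le i\le m$, $k\ge0$), let $T\ge1$ be the unique integer with $\widetilde{\alpha}_{w(m+s)}<\xi_{m+s+1}$ for $1\le s<T$ and $\widetilde{\alpha}_{w(m+T)}>\xi_{m+T+1}$, let $t=((T-1)\bmod m)+1$, $k=(T-t)/m$, and define $\beta$ by $\beta_{w(i)}=\alpha_{w(i)}-(k+1)n$ for $1\le i\le t$, $\beta_{w(i)}=\alpha_{w(i)}-kn$ for $t<i\le m$, $\beta_{w(i)}=\alpha_{w(i)}+n$ for $m+1\le i\le m+T$, $\beta_{w(i)}=\alpha_{w(i)}$ for $i>m+T$. For $1\le i\le N$ let $\varepsilon(i)\in\mathbb{N}_0^N$ be the standard basis vector, and for $0\le s\le T$ let $$\beta^{(s)}:=\alpha-n\sum_{i=1}^{s}\Big(\varepsilon\big(w(((i-1)\bmod m)+1)\big)-\varepsilon\big(w(m+i)\big)\Big).$$ Then $\beta^{(0)}=\alpha$, $\beta^{(T)}=\beta$, and $\beta^{(s)}\vartriangleright\beta^{(s+1)}$ for $0\le s<T$.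
   Context: $\mathbb{N}_0=\{0,1,2,\ldots\}$, $|\alpha|=\sum_i\alpha_i$, $\ell(\alpha)=\max\{j:\alpha_j>0\}$. Rank: $r(\alpha,i)=\#\{j:\alpha_j>\alpha_i\}+\#\{j:1\le j\le i,\ \alpha_j=\alpha_i\}$. Leg-length: $L(\alpha;i,j)=\#\{l:l>i,\ j\le\alpha_l\le\alpha_i\}+\#\{l:l<i,\ j\le\alpha_l+1\le\alpha_i\}$. $\alpha^+$ is the weakly decreasing rearrangement of $\alpha$; $\alpha\succ\beta$ means $\alpha\ne\beta$ and $\sum_{i\le j}\alpha_i\ge\sum_{i\le j}\beta_i$ for all $j$; $\alpha\vartriangleright\beta$ means $|\alpha|=|\beta|$ and either $\alpha^+\succ\beta^+$, or $\alpha^+=\beta^+$ and $\alpha\succ\beta$. -}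

module Defs where

open import Data.Nat.ListAction using (sum)
open import Data.Nat as ℕ using (ℕ; zero; suc; _⊔_; _∸_; _<ᵇ_; _≡ᵇ_; _≤ᵇ_)
open import Data.Integer as ℤ using (ℤ; +_)
open import Data.Rational as ℚ using (ℚ)
open import Data.Bool using (Bool; true; false; if_then_else_; _∧_)
open import Data.List as List using (List; []; _∷_; upTo; take; length; filter)
open import Data.Vec as Vec using (Vec; []; _∷_; toList; tabulate; zipWith; replicate)
open import Data.Fin using (Fin; toℕ)
open import Data.Product using (_×_)
open import Data.Sum using (_⊎_)
open import Relation.Nullary using (¬_)
open import Relation.Binary.PropositionalEquality using (_≡_)
open import Relation.Unary using (Decidable)
open import Relation.Nullary.Decidable using (yes; no)
open import Data.Bool.Properties using (T?)
open import Data.Bool using (T)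
import Data.Integer.Properties as ℤP
import Relation.Binary.Construct.Flip.EqAndOrd as Flip
import Data.List.Sort as Sort

-- Positions are
-- 1-based natural numbers as in the paper: `α ‼ p` is α_p for
-- 1 ≤ p ≤ N (and 0 outside that range; this default is never used by
-- the statement, all positions used there lie in 1..N).

lk : ∀ {A : Set} {n} → A → Vec A n → ℕ → A
lk d []       _       = d
lk d (x ∷ xs) zero    = x
lk d (x ∷ xs) (suc k) = lk d xs k

infixl 9 _‼_ _‼ℤ_
_‼_ : ∀ {N} → Vec ℕ N → ℕ → ℕ
α ‼ zero  = 0
α ‼ suc p = lk 0 α p

_‼ℤ_ : ∀ {N} → Vec ℤ N → ℕ → ℤ
β ‼ℤ zero  = + 0
β ‼ℤ suc p = lk (+ 0) β p

positions : ℕ → List ℕ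
positions N = List.map suc (upTo N)

count : ℕ → (ℕ → Bool) → ℕ
count N P = length (filter (λ j → T? (P j)) (positions N))

∣_∣ : ∀ {N} → Vec ℕ N → ℕ
∣ α ∣ = sum (toList α)

ℓ : ∀ {N} → Vec ℕ N → ℕ
ℓ {N} α = List.foldr _⊔_ 0
  (List.map (λ j → if 0 <ᵇ (α ‼ j) then j else 0) (positions N))

rank : ∀ {N} → Vec ℕ N → ℕ → ℕ
rank {N} α i =
  count N (λ j → (α ‼ i) <ᵇ (α ‼ j)) ℕ.+
  count N (λ j → (j ≤ᵇ i) ∧ ((α ‼ j) ≡ᵇ (α ‼ i)))

leg : ∀ {N} → Vec ℕ N → ℕ → ℕ → ℕ
leg {N} α i j =
  count N (λ l → (i <ᵇ l) ∧ ((j ≤ᵇ (α ‼ l)) ∧ ((α ‼ l) ≤ᵇ (α ‼ i)))) ℕ.+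
  count N (λ l → (l <ᵇ i) ∧ ((j ≤ᵇ suc (α ‼ l)) ∧ (suc (α ‼ l) ≤ᵇ (α ‼ i))))

υ : ℕ → ℚ
υ N = + 1 ℚ./ suc N

αtil : ∀ {N} → Vec ℕ N → ℕ → ℚ
αtil {N} α i = (+ (α ‼ i) ℚ./ 1) ℚ.- ((+ i ℚ./ 1) ℚ.* υ N)

ε : (N : ℕ) → ℕ → Vec ℤ N
ε N p = tabulate (λ j → if suc (toℕ j) ≡ᵇ p then + 1 else + 0)

_⊕_ : ∀ {N} → Vec ℤ N → Vec ℤ N → Vec ℤ N
_⊕_ = zipWith ℤ._+_

_⊖_ : ∀ {N} → Vec ℤ N → Vec ℤ N → Vec ℤ N
_⊖_ = zipWith ℤ._-_

_·_ : ∀ {N} → ℤ → Vec ℤ N → Vec ℤ N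
c · v = Vec.map (c ℤ.*_) v

Σ[1…_] : ∀ {N} → ℕ → (ℕ → Vec ℤ N) → Vec ℤ N
Σ[1… s ] f = List.foldr _⊕_ (replicate _ (+ 0)) (List.map f (positions s))

toℤ : ∀ {N} → Vec ℕ N → Vec ℤ N
toℤ = Vec.map +_

module Dec = Sort (Flip.decTotalOrder ℤP.≤-decTotalOrder)

infix 25 _⁺
infix 4 _≻_ _⊳_
_⁺ : ∀ {N} → Vec ℤ N → List ℤ
α ⁺ = Dec.sort (toList α)

sumℤ : List ℤ → ℤ
sumℤ = List.foldr ℤ._+_ (+ 0)

psum : List ℤ → ℕ → ℤ
psum xs j = sumℤ (take j xs)

_≻_ : List ℤ → List ℤ → Set
xs ≻ ys = ¬ (xs ≡ ys) × (∀ j → psum ys j ℤ.≤ psum xs j)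

_⊳_ : ∀ {N} → Vec ℤ N → Vec ℤ N → Set
α ⊳ β = (sumℤ (toList α) ≡ sumℤ (toList β)) ×
        ((α ⁺ ≻ β ⁺) ⊎ ((α ⁺ ≡ β ⁺) × (toList α ≻ toList β)))

{-# OPTIONS --safe #-}
-- Write α̃_i = α_i − iυ, so that w lists the positions by decreasing α̃. Step s+1 moves n units
-- from the source w((s mod m)+1) to the destination w(m+s+1), and moving n from an entry x_p to
-- an entry x_q decreases x in ⊳ as soon as x_q + n < x_p, or x_q + n = x_p with p < q. In the
-- first case the sum of squares drops, so the sorted vectors differ, and inserting the two changed
-- entries into the same sorted rest shows that no sorted partial sum grows; in the second case
-- the two entries are merely exchanged and the partial sums of x drop between p and q.
-- Before step s+1 the source has given n⌊s/m⌋ and the destination nothing, so the condition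
-- reads α̃_{w(m+s+1)} + n(⌊s/m⌋+1) < α̃_{w((s mod m)+1)}. For s ≥ 1 it follows from
-- α̃_{w(m+s)} < ξ_{m+s+1}, since w(m+s+1) ranks below w(m+s); for s = 0 it is what the choice of
-- m as one plus a leg length guarantees.
module Submission where

open import Defs
open import Data.Nat using (ℕ)


module Positions where
  open import Data.Nat as ℕ using (ℕ; zero; suc; s≤s; z≤n; _⊓_)
  import Data.Nat.Properties as ℕP
  open import Data.Integer using (ℤ; +_; _+_)
  import Data.Integer.Properties as ℤP
  open import Data.List using ([]; _∷_; _++_; [_]; map; take; length; upTo; applyUpTo)
  import Data.List.Properties as ListP
  open import Data.List.Membership.Propositional using (_∈_)
  open import Data.List.Membership.Propositional.Properties using (∈-map⁺; ∈-map⁻; ∈-upTo⁺; ∈-upTo⁻)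
  open import Data.List.Relation.Unary.Unique.Propositional using (Unique)
  import Data.List.Relation.Unary.Unique.Propositional.Properties as UniqueP
  open import Data.List.Relation.Binary.Permutation.Propositional using (_↭_; module _↭_)
  open import Data.Vec as Vec using (Vec; toList)
  open import Data.Product using (_×_; _,_)
  open import Function using (_∘_)
  open import Relation.Binary.PropositionalEquality hiding ([_])

  InRange : ℕ → ℕ → Set
  InRange N l = 1 ℕ.≤ l × l ℕ.≤ N

  positions-suc : ∀ N → positions (suc N) ≡ positions N ++ [ suc N ]
  positions-suc N = trans (cong (map suc) (sym (ListP.upTo-∷ʳ N))) (ListP.map-++ suc (upTo N) [ N ])

  positions-unique : ∀ N → Unique (positions N)
  positions-unique N = UniqueP.map⁺ ℕP.suc-injective (UniqueP.upTo⁺ N)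

  ∈-positions⁺ : ∀ {N l} → InRange N l → l ∈ positions N
  ∈-positions⁺ {l = suc i} (_ , i<N) = ∈-map⁺ suc (∈-upTo⁺ i<N)

  ∈-positions⁻ : ∀ {N l} → l ∈ positions N → InRange N l
  ∈-positions⁻ l∈ with ∈-map⁻ suc l∈
  ... | _ , i∈ , refl = s≤s z≤n , ∈-upTo⁻ i∈

  length-positions : ∀ N → length (positions N) ≡ N
  length-positions N = trans (ListP.length-map suc (upTo N)) (ListP.length-upTo N)

  toList-‼ℤ : ∀ {N} (v : Vec ℤ N) → toList v ≡ map (v ‼ℤ_) (positions N)
  toList-‼ℤ {N} v = trans (lookups v) (trans (sym (ListP.map-upTo (lk (+ 0) v) N)) (ListP.map-∘ (upTo N)))
    where
    lookups : ∀ {N} (v : Vec ℤ N) → toList v ≡ applyUpTo (lk (+ 0) v) N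
    lookups Vec.[] = refl
    lookups (x Vec.∷ v) = cong (x ∷_) (lookups v)

  sumℤ-++ : ∀ xs ys → sumℤ (xs ++ ys) ≡ sumℤ xs + sumℤ ys
  sumℤ-++ [] ys = sym (ℤP.+-identityˡ _)
  sumℤ-++ (x ∷ xs) ys = trans (cong (_+_ x) (sumℤ-++ xs ys)) (sym (ℤP.+-assoc x _ _))

  sumℤ-↭ : ∀ {xs ys} → xs ↭ ys → sumℤ xs ≡ sumℤ ys
  sumℤ-↭ _↭_.refl = refl
  sumℤ-↭ (_↭_.prep x p) = cong (_+_ x) (sumℤ-↭ p)
  sumℤ-↭ (_↭_.swap x y p) =
    trans (sym (ℤP.+-assoc x y _)) (trans (cong₂ _+_ (ℤP.+-comm x y) (sumℤ-↭ p)) (ℤP.+-assoc y x _))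
  sumℤ-↭ (_↭_.trans p q) = trans (sumℤ-↭ p) (sumℤ-↭ q)

  Σ≤ : (ℕ → ℤ) → ℕ → ℤ
  Σ≤ f k = sumℤ (map f (positions k))

  Σ≤-suc : ∀ f k → Σ≤ f (suc k) ≡ Σ≤ f k + f (suc k)
  Σ≤-suc f k = begin
    sumℤ (map f (positions (suc k)))          ≡⟨ cong (sumℤ ∘ map f) (positions-suc k) ⟩
    sumℤ (map f (positions k ++ [ suc k ]))   ≡⟨ cong sumℤ (ListP.map-++ f (positions k) [ suc k ]) ⟩
    sumℤ (map f (positions k) ++ [ f (suc k) ]) ≡⟨ sumℤ-++ (map f (positions k)) [ f (suc k) ] ⟩
    Σ≤ f k + (f (suc k) + + 0)                ≡⟨ cong (_+_ (Σ≤ f k)) (ℤP.+-identityʳ (f (suc k))) ⟩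
    Σ≤ f k + f (suc k)                        ∎
    where open ≡-Reasoning

  take-positions : ∀ j N → take j (positions N) ≡ positions (j ⊓ N)
  take-positions j N = begin
    take j (map suc (upTo N))         ≡⟨ ListP.take-map j (upTo N) ⟩
    map suc (take j (upTo N))         ≡⟨ cong (map suc) (take-applyUpTo (λ i → i) j N) ⟩
    map suc (upTo (j ⊓ N))            ∎
    where
    open ≡-Reasoning
    take-applyUpTo : ∀ (h : ℕ → ℕ) j N → take j (applyUpTo h N) ≡ applyUpTo h (j ⊓ N)
    take-applyUpTo h zero N = refl
    take-applyUpTo h (suc j) zero = refl
    take-applyUpTo h (suc j) (suc N) = cong (h 0 ∷_) (take-applyUpTo (h ∘ suc) j N)

  psum-positions : ∀ f N j → psum (map f (positions N)) j ≡ Σ≤ f (j ⊓ N)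
  psum-positions f N j = cong sumℤ (trans (ListP.take-map j (positions N)) (cong (map f) (take-positions j N)))


module Counting where
  open import Data.Nat as ℕ using (ℕ; suc; _+_; _≤_; s≤s; z≤n)
  import Data.Nat.Properties as ℕP
  open import Data.List using (List; []; _∷_; _++_; [_]; length; filter)
  import Data.List.Properties as ListP
  open import Data.List.Membership.Propositional using (_∈_)
  open import Data.List.Relation.Unary.Any using (here; there)
  open import Data.Empty using (⊥; ⊥-elim)
  open import Relation.Binary.PropositionalEquality hiding ([_])
  open import Relation.Nullary using (yes; no)
  open import Relation.Unary using (Pred; Decidable)
  open import Relation.Unary.Properties using (_∪?_; ∁?)
  open import Data.List.Relation.Unary.All as All using ()
  open import Data.List.Relation.Unary.Unique.Propositional using (Unique; _∷_)
  open import Data.List.Relation.Binary.Permutation.Propositional using (_↭_; ↭-refl; ↭-sym; ↭-trans; ↭-prep)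
  import Data.List.Relation.Binary.Permutation.Propositional.Properties as PermP
  open Positions using (InRange; positions-unique; ∈-positions⁺)

  count⟨_⟩_ : ∀ {a p} {A : Set a} {P : Pred A p} → Decidable P → List A → ℕ
  count⟨ P? ⟩ xs = length (filter P? xs)

  module _ {a p q} {A : Set a} {P : Pred A p} {Q : Pred A q} (P? : Decidable P) (Q? : Decidable Q) where

    count-mono : ∀ xs → (∀ {x} → x ∈ xs → P x → Q x) → count⟨ P? ⟩ xs ≤ count⟨ Q? ⟩ xs
    count-mono [] _ = z≤n
    count-mono (x ∷ xs) P⇒Q with P? x | Q? x
    ... | yes _ | yes _ = s≤s (count-mono xs (λ x∈ → P⇒Q (there x∈)))
    ... | yes px | no ¬qx = ⊥-elim (¬qx (P⇒Q (here refl) px))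
    ... | no _ | yes _ = ℕP.m≤n⇒m≤1+n (count-mono xs (λ x∈ → P⇒Q (there x∈)))
    ... | no _ | no _ = count-mono xs (λ x∈ → P⇒Q (there x∈))

    count-∪ : (∀ {x} → P x → Q x → ⊥) → ∀ xs → count⟨ P? ∪? Q? ⟩ xs ≡ count⟨ P? ⟩ xs + count⟨ Q? ⟩ xs
    count-∪ disjoint [] = refl
    count-∪ disjoint (x ∷ xs) with P? x | Q? x
    ... | yes px | yes qx = ⊥-elim (disjoint px qx)
    ... | yes _ | no _ = cong suc (count-∪ disjoint xs)
    ... | no _ | yes _ = trans (cong suc (count-∪ disjoint xs)) (sym (ℕP.+-suc _ _))
    ... | no _ | no _ = count-∪ disjoint xs

  count-≐ : ∀ {a p q} {A : Set a} {P : Pred A p} {Q : Pred A q} (P? : Decidable P) (Q? : Decidable Q) xs →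
            (∀ {x} → P x → Q x) → (∀ {x} → Q x → P x) → count⟨ P? ⟩ xs ≡ count⟨ Q? ⟩ xs
  count-≐ P? Q? xs P⇒Q Q⇒P = ℕP.≤-antisym (count-mono P? Q? xs (λ _ → P⇒Q)) (count-mono Q? P? xs (λ _ → Q⇒P))

  filter-≟-unique : ∀ {p xs} → Unique xs → p ∈ xs → filter (ℕ._≟ p) xs ≡ [ p ]
  filter-≟-unique {p} {x ∷ xs} (x∉xs ∷ _) (here refl) =
    trans (ListP.filter-accept (ℕ._≟ p) refl)
          (cong (p ∷_) (ListP.filter-none (ℕ._≟ p) (All.map (λ x≢y y≡x → x≢y (sym y≡x)) x∉xs)))
  filter-≟-unique {p} {x ∷ xs} (x∉xs ∷ unique) (there p∈xs) =
    trans (ListP.filter-reject (ℕ._≟ p) (All.lookup x∉xs p∈xs)) (filter-≟-unique unique p∈xs)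

  filter-partition-↭ : ∀ {a p} {A : Set a} {P : Pred A p} (P? : Decidable P) xs → xs ↭ filter P? xs ++ filter (∁? P?) xs
  filter-partition-↭ P? [] = ↭-refl
  filter-partition-↭ P? (x ∷ xs) with P? x
  ... | yes _ = ↭-prep x (filter-partition-↭ P? xs)
  ... | no _ = ↭-trans (↭-prep x (filter-partition-↭ P? xs)) (↭-sym (PermP.shift x (filter P? xs) _))

  without : ℕ → List ℕ → List ℕ
  without p = filter (∁? (ℕ._≟ p))

  ↭-pluck : ∀ {p xs} → Unique xs → p ∈ xs → xs ↭ p ∷ without p xs
  ↭-pluck {p} {xs} unique p∈xs =
    subst (λ ys → xs ↭ ys ++ without p xs) (filter-≟-unique unique p∈xs) (filter-partition-↭ (ℕ._≟ p) xs)

  count-positions-≟ : ∀ {N p} → InRange N p → count⟨ ℕ._≟ p ⟩ (positions N) ≡ 1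
  count-positions-≟ {N} p∈ = cong length (filter-≟-unique (positions-unique N) (∈-positions⁺ p∈))


module Majorization where
  open import Data.Nat as ℕ using (ℕ; zero; suc; s≤s; z≤n)
  import Data.Nat.Properties as ℕP
  open import Data.Integer using (+_; _+_; _≤_)
  import Data.Integer.Properties as ℤP
  open import Data.List using ([]; _∷_; length)
  open import Data.List.Relation.Binary.Permutation.Propositional using (_↭_; ↭-sym; ↭-trans; ↭-prep; ↭⇒↭ₛ)
  import Data.List.Relation.Binary.Pointwise as Pointwise
  open import Data.List.Relation.Unary.Linked using ([]; [-]; _∷_)
  open import Data.List.Relation.Unary.Sorted.TotalOrder.Properties using (↗↭↗⇒≋)
  open import Data.Product using (_×_; _,_)
  open import Data.Sum using (_⊎_; inj₁; inj₂)
  open import Relation.Binary.Bundles using (DecTotalOrder)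
  import Relation.Binary.Construct.Flip.EqAndOrd as Flip
  open import Relation.Binary.PropositionalEquality
  open import Relation.Nullary using (yes; no)
  import Data.List.Relation.Binary.Permutation.Propositional.Properties as PermP

  -- The order under which `Dec.sort` sorts, so `Sorted` means weakly decreasing.
  O : DecTotalOrder _ _ _
  O = Flip.decTotalOrder ℤP.≤-decTotalOrder

  open DecTotalOrder O using (totalOrder)
  open import Data.List.Relation.Unary.Sorted.TotalOrder totalOrder using (Sorted)
  open import Data.List.Sort.InsertionSort.Base O using (insert) public
  open import Data.List.Sort.InsertionSort.Properties O using (insert-↭; insert-↗)
  open ℤP.≤-Reasoning

  sorted-↭⇒≡ : ∀ {xs ys} → Sorted xs → Sorted ys → xs ↭ ys → xs ≡ ys
  sorted-↭⇒≡ sxs sys xs↭ys = Pointwise.Pointwise-≡⇒≡ (↗↭↗⇒≋ totalOrder sxs sys (↭⇒↭ₛ xs↭ys))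

  sort-↭⇒≡ : ∀ {xs ys} → xs ↭ ys → Dec.sort xs ≡ Dec.sort ys
  sort-↭⇒≡ {xs} {ys} xs↭ys = sorted-↭⇒≡ (Dec.sort-↗ xs) (Dec.sort-↗ ys)
    (↭-trans (Dec.sort-↭ xs) (↭-trans xs↭ys (↭-sym (Dec.sort-↭ ys))))

  sort-∷ : ∀ x xs → Dec.sort (x ∷ xs) ≡ insert x (Dec.sort xs)
  sort-∷ x xs = sorted-↭⇒≡ (Dec.sort-↗ (x ∷ xs)) (insert-↗ x (Dec.sort-↗ xs))
    (↭-trans (Dec.sort-↭ (x ∷ xs)) (↭-sym (↭-trans (insert-↭ x _) (↭-prep x (Dec.sort-↭ xs)))))

  length-insert : ∀ v xs → length (insert v xs) ≡ suc (length xs)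
  length-insert v xs = PermP.↭-length (insert-↭ v xs)

  psum-insert-≥ : ∀ v xs j → psum xs j + v ≤ psum (insert v xs) (suc j)
  psum-insert-≥ v [] zero = ℤP.≤-reflexive (ℤP.+-comm (+ 0) v)
  psum-insert-≥ v [] (suc j) = ℤP.≤-reflexive (ℤP.+-comm (+ 0) v)
  psum-insert-≥ v (x ∷ xs) j with x ℤP.≤? v
  ... | yes _ = ℤP.≤-reflexive (ℤP.+-comm (psum (x ∷ xs) j) v)
  psum-insert-≥ v (x ∷ xs) zero | no x≰v =
    subst₂ _≤_ (sym (ℤP.+-identityˡ v)) (sym (ℤP.+-identityʳ x)) (ℤP.<⇒≤ (ℤP.≰⇒> x≰v))
  psum-insert-≥ v (x ∷ xs) (suc j) | no _ = begin
    x + psum xs j + v             ≡⟨ ℤP.+-assoc x (psum xs j) v ⟩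
    x + (psum xs j + v)           ≤⟨ ℤP.+-monoʳ-≤ x (psum-insert-≥ v xs j) ⟩
    x + psum (insert v xs) (suc j) ∎

  psum-insert-cases : ∀ v xs j →
    psum (insert v xs) (suc j) ≡ psum xs j + v ⊎
    (suc j ℕ.≤ length xs × psum (insert v xs) (suc j) ≡ psum xs (suc j))
  psum-insert-cases v [] zero = inj₁ (ℤP.+-comm v (+ 0))
  psum-insert-cases v [] (suc j) = inj₁ (ℤP.+-comm v (+ 0))
  psum-insert-cases v (x ∷ xs) j with x ℤP.≤? v
  ... | yes _ = inj₁ (ℤP.+-comm v (psum (x ∷ xs) j))
  psum-insert-cases v (x ∷ xs) zero | no _ = inj₂ (s≤s z≤n , refl)
  psum-insert-cases v (x ∷ xs) (suc j) | no _ with psum-insert-cases v xs j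
  ... | inj₁ eq = inj₁ (trans (cong (_+_ x) eq) (sym (ℤP.+-assoc x (psum xs j) v)))
  ... | inj₂ (j<len , eq) = inj₂ (s≤s j<len , cong (_+_ x) eq)

  psum-∷-mono : ∀ {v x xs} j → Sorted (x ∷ xs) → x ≤ v → j ℕ.≤ length xs →
    psum (x ∷ xs) (suc j) ≤ psum (v ∷ x ∷ xs) (suc j)
  psum-∷-mono zero _ x≤v _ = ℤP.+-monoˡ-≤ (+ 0) x≤v
  psum-∷-mono {v} {x} {y ∷ ys} (suc j) (y≤x ∷ sorted) x≤v (s≤s j≤len) = begin
    x + (y + psum ys j)         ≤⟨ ℤP.+-monoʳ-≤ x (psum-∷-mono j sorted y≤x j≤len) ⟩
    x + (x + psum (y ∷ ys) j)   ≤⟨ ℤP.+-monoˡ-≤ _ x≤v ⟩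
    v + (x + psum (y ∷ ys) j)   ∎

  psum-insert-mono : ∀ v xs j → Sorted xs → j ℕ.≤ length xs → psum xs j ≤ psum (insert v xs) j
  psum-insert-mono v [] zero _ _ = ℤP.≤-refl
  psum-insert-mono v (x ∷ xs) j sorted j≤len with x ℤP.≤? v
  psum-insert-mono v (x ∷ xs) zero sorted j≤len | _ = ℤP.≤-refl
  psum-insert-mono v (x ∷ xs) (suc j) sorted (s≤s j≤len) | yes x≤v = psum-∷-mono j sorted x≤v j≤len
  psum-insert-mono v (x ∷ xs) (suc j) sorted (s≤s j≤len) | no _ =
    ℤP.+-monoʳ-≤ x (psum-insert-mono v xs j (tail sorted) j≤len)
    where
    tail : ∀ {x xs} → Sorted (x ∷ xs) → Sorted xs
    tail [-] = []
    tail (_ ∷ sorted) = sorted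

  psum-insert₂-mono : ∀ {a b a′ b′} xs → Sorted xs → a′ + b′ ≡ a + b → a′ ≤ a → b′ ≤ a →
    ∀ j → j ℕ.≤ length xs →
    psum (insert a′ (insert b′ xs)) (suc j) ≤ psum (insert a (insert b xs)) (suc j)
  psum-insert₂-mono {a} {b} {a′} {b′} xs sorted sum≡ a′≤a b′≤a j j≤len
    with psum-insert-cases a′ (insert b′ xs) j
  ... | inj₁ eq rewrite eq = a′-among-first j j≤len
    where
    b′+a′≡b+a : b′ + a′ ≡ b + a
    b′+a′≡b+a = trans (ℤP.+-comm b′ a′) (trans sum≡ (ℤP.+-comm a b))
    a′-among-first : ∀ j → j ℕ.≤ length xs → psum (insert b′ xs) j + a′ ≤ psum (insert a (insert b xs)) (suc j)
    a′-among-first zero _ = ℤP.≤-trans (ℤP.+-monoʳ-≤ (+ 0) a′≤a) (psum-insert-≥ a (insert b xs) zero)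
    a′-among-first (suc i) i<len with psum-insert-cases b′ xs i
    ... | inj₁ eq′ rewrite eq′ = begin
      psum xs i + b′ + a′                  ≡⟨ ℤP.+-assoc (psum xs i) b′ a′ ⟩
      psum xs i + (b′ + a′)                ≡⟨ cong (_+_ (psum xs i)) b′+a′≡b+a ⟩
      psum xs i + (b + a)                  ≡⟨ ℤP.+-assoc (psum xs i) b a ⟨
      psum xs i + b + a                    ≤⟨ ℤP.+-monoˡ-≤ a (psum-insert-≥ b xs i) ⟩
      psum (insert b xs) (suc i) + a       ≤⟨ psum-insert-≥ a (insert b xs) (suc i) ⟩
      psum (insert a (insert b xs)) (suc (suc i)) ∎
    ... | inj₂ (_ , eq′) rewrite eq′ = begin
      psum xs (suc i) + a′                 ≤⟨ ℤP.+-monoʳ-≤ (psum xs (suc i)) a′≤a ⟩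
      psum xs (suc i) + a                  ≤⟨ ℤP.+-monoˡ-≤ a (psum-insert-mono b xs (suc i) sorted i<len) ⟩
      psum (insert b xs) (suc i) + a       ≤⟨ psum-insert-≥ a (insert b xs) (suc i) ⟩
      psum (insert a (insert b xs)) (suc (suc i)) ∎
  ... | inj₂ (j<len , eq) rewrite eq with psum-insert-cases b′ xs j
  ...   | inj₁ eq′ rewrite eq′ = begin
    psum xs j + b′                         ≤⟨ ℤP.+-monoʳ-≤ (psum xs j) b′≤a ⟩
    psum xs j + a                          ≤⟨ ℤP.+-monoˡ-≤ a (psum-insert-mono b xs j sorted j≤len) ⟩
    psum (insert b xs) j + a               ≤⟨ psum-insert-≥ a (insert b xs) j ⟩
    psum (insert a (insert b xs)) (suc j) ∎
  ...   | inj₂ (j<len′ , eq′) rewrite eq′ = begin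
    psum xs (suc j)                        ≤⟨ psum-insert-mono b xs (suc j) sorted j<len′ ⟩
    psum (insert b xs) (suc j)             ≤⟨ psum-insert-mono a (insert b xs) (suc j) (insert-↗ b sorted)
                                                (ℕP.≤-trans (ℕP.m≤n⇒m≤1+n j<len′)
                                                            (ℕP.≤-reflexive (sym (length-insert b xs)))) ⟩
    psum (insert a (insert b xs)) (suc j)  ∎


module Transfer where
  open import Data.Nat as ℕ using (ℕ; zero; suc; s≤s; z≤n; _⊓_)
  import Data.Nat.Properties as ℕP
  open import Data.Integer as ℤ using (ℤ; +_; _+_; _-_; _*_; _≤_; _<_)
  import Data.Integer.Properties as ℤP
  open import Data.Integer.Tactic.RingSolver using (solve-∀)
  open import Data.List using (List; _∷_; map; length)
  import Data.List.Properties as ListP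
  open import Data.List.Membership.Propositional using (_∈_)
  open import Data.List.Membership.Propositional.Properties using (∈-filter⁺; ∈-filter⁻)
  open import Data.List.Relation.Unary.All as All using ()
  import Data.List.Relation.Unary.Unique.Propositional.Properties as UniqueP
  open import Data.List.Relation.Binary.Permutation.Propositional using (_↭_; ↭-refl; ↭-sym; ↭-trans; ↭-prep; ↭-swap)
  import Data.List.Relation.Binary.Permutation.Propositional.Properties as PermP
  open import Data.Vec as Vec using (Vec; toList)
  import Data.Vec.Properties as VecP
  open import Data.Product using (_×_; _,_; proj₁; proj₂)
  open import Data.Sum using (_⊎_; inj₁; inj₂)
  open import Data.Empty using (⊥-elim)
  open import Function using (_∘_)
  open import Relation.Binary.PropositionalEquality
  open import Relation.Nullary using (yes; no; ¬_)
  open import Algebra.Bundles using (AbelianGroup)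
  open import Algebra.Properties.Group (AbelianGroup.group ℤP.+-0-abelianGroup) using () renaming (∙-cancelˡ to +-cancelˡ)
  open Majorization
  open Positions
  open Counting using (without; ↭-pluck)

  others : ℕ → ℕ → ℕ → List ℕ
  others N p q = without q (without p (positions N))

  positions-↭ : ∀ {N p q} → InRange N p → InRange N q → p ≢ q → positions N ↭ p ∷ q ∷ others N p q
  positions-↭ {N} {p} {q} p∈ q∈ p≢q = ↭-trans (↭-pluck (positions-unique N) (∈-positions⁺ p∈))
    (↭-prep p (↭-pluck (UniqueP.filter⁺ _ (positions-unique N)) (∈-filter⁺ _ (∈-positions⁺ q∈) (p≢q ∘ sym))))

  ∈-others⁻ : ∀ {N p q l} → l ∈ others N p q → InRange N l × l ≢ p × l ≢ q
  ∈-others⁻ l∈ with ∈-filter⁻ _ l∈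
  ... | l∈′ , l≢q with ∈-filter⁻ _ l∈′
  ... | l∈″ , l≢p = ∈-positions⁻ l∈″ , l≢p , l≢q

  record IsTransfer {N} (x y : Vec ℤ N) (p q n : ℕ) : Set where
    field
      p∈ : InRange N p
      q∈ : InRange N q
      p≢q : p ≢ q
      at-p : y ‼ℤ p ≡ x ‼ℤ p - + n
      at-q : y ‼ℤ q ≡ x ‼ℤ q + + n
      elsewhere : ∀ l → InRange N l → l ≢ p → l ≢ q → y ‼ℤ l ≡ x ‼ℤ l

  module _ {N} {x y : Vec ℤ N} {p q n} (t : IsTransfer x y p q n) where
    open IsTransfer t

    private
      a = x ‼ℤ p
      b = x ‼ℤ q
      rest = map (x ‼ℤ_) (others N p q)
      S = Dec.sort rest

    toList-↭ˣ : toList x ↭ a ∷ b ∷ rest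
    toList-↭ˣ = subst (_↭ a ∷ b ∷ rest) (sym (toList-‼ℤ x)) (PermP.map⁺ (x ‼ℤ_) (positions-↭ p∈ q∈ p≢q))

    toList-↭ʸ : toList y ↭ (a - + n) ∷ (b + + n) ∷ rest
    toList-↭ʸ = subst₂ _↭_ (sym (toList-‼ℤ y)) (cong₂ _∷_ at-p (cong₂ _∷_ at-q rest-unchanged))
      (PermP.map⁺ (y ‼ℤ_) (positions-↭ p∈ q∈ p≢q))
      where
      unchanged : ∀ {l} → l ∈ others N p q → y ‼ℤ l ≡ x ‼ℤ l
      unchanged l∈ with ∈-others⁻ l∈
      ... | l∈N , l≢p , l≢q = elsewhere _ l∈N l≢p l≢q
      rest-unchanged : map (y ‼ℤ_) (others N p q) ≡ rest
      rest-unchanged = ListP.map-cong-local (All.tabulate unchanged)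

    transfer-sumℤ : sumℤ (toList x) ≡ sumℤ (toList y)
    transfer-sumℤ = trans (sumℤ-↭ toList-↭ˣ) (trans (moved a b (+ n) (sumℤ rest)) (sym (sumℤ-↭ toList-↭ʸ)))
      where
      moved : ∀ a b n r → a + (b + r) ≡ a - n + (b + n + r)
      moved = solve-∀

    private
      sort-two : ∀ {v} u w → v ↭ u ∷ w ∷ rest → Dec.sort v ≡ insert u (insert w S)
      sort-two u w v↭ = trans (sort-↭⇒≡ v↭) (trans (sort-∷ u (w ∷ rest)) (cong (insert u) (sort-∷ w rest)))

      psum-whole : ∀ (v : Vec ℤ N) u w j → toList v ↭ u ∷ w ∷ rest → length S ℕ.< j →
                   psum (v ⁺) (suc j) ≡ sumℤ (toList v)
      psum-whole v u w j v↭ S<j = begin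
        psum (v ⁺) (suc j)   ≡⟨ cong sumℤ (ListP.take-all (suc j) (v ⁺) len≤) ⟩
        sumℤ (v ⁺)           ≡⟨ sumℤ-↭ (Dec.sort-↭ (toList v)) ⟩
        sumℤ (toList v)      ∎
        where
        open ≡-Reasoning
        len≤ : length (v ⁺) ℕ.≤ suc j
        len≤ = subst (ℕ._≤ suc j)
          (sym (trans (cong length (sort-two u w v↭)) (trans (length-insert u (insert w S)) (cong suc (length-insert w S)))))
          (s≤s S<j)

    gap⇒⁺≻ : 1 ℕ.≤ n → b + + n < a → x ⁺ ≻ y ⁺
    gap⇒⁺≻ 1≤n b+n<a = sorted-differ , prefix-sums
      where
      a′≤a : a - + n ≤ a
      a′≤a = ℤP.i-j≤i a (+ n)
      b′≤a : b + + n ≤ a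
      b′≤a = ℤP.<⇒≤ b+n<a
      moved : a - + n + (b + + n) ≡ a + b
      moved = shift a b (+ n)
        where
        shift : ∀ a b n → a - n + (b + n) ≡ a + b
        shift = solve-∀
      prefix-sums : ∀ j → psum (y ⁺) j ≤ psum (x ⁺) j
      prefix-sums zero = ℤP.≤-refl
      prefix-sums (suc j) with j ℕ.≤? length S
      ... | yes j≤S = subst₂ (λ u v → psum u (suc j) ≤ psum v (suc j))
                        (sym (sort-two _ _ toList-↭ʸ)) (sym (sort-two _ _ toList-↭ˣ))
                        (psum-insert₂-mono S (Dec.sort-↗ rest) moved a′≤a b′≤a j j≤S)
      ... | no j≰S = ℤP.≤-reflexive (trans (psum-whole y _ _ j toList-↭ʸ (ℕP.≰⇒> j≰S))
                       (trans (sym transfer-sumℤ) (sym (psum-whole x _ _ j toList-↭ˣ (ℕP.≰⇒> j≰S)))))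
      sq : ℤ → ℤ
      sq z = z * z
      Q = sumℤ (map sq rest)
      D = a - + n - b
      sum-sq : ∀ {v} u w → toList v ↭ u ∷ w ∷ rest → sumℤ (map sq (v ⁺)) ≡ sq u + (sq w + Q)
      sum-sq u w v↭ = sumℤ-↭ (PermP.map⁺ sq (↭-trans (Dec.sort-↭ _) v↭))
      -- The sum of squares drops by 2n(a − n − b) > 0, so the sorted vectors differ.
      squares : ∀ a b n r → a * a + (b * b + r) ≡
                (a - n) * (a - n) + ((b + n) * (b + n) + r) + n * ((a - n - b) + (a - n - b))
      squares = solve-∀
      drop-vanishes : x ⁺ ≡ y ⁺ → + n * (D + D) ≡ + 0
      drop-vanishes x⁺≡y⁺ = +-cancelˡ (sq (a - + n) + (sq (b + + n) + Q)) (+ n * (D + D)) (+ 0) (begin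
        sq (a - + n) + (sq (b + + n) + Q) + + n * (D + D) ≡⟨ squares a b (+ n) Q ⟨
        sq a + (sq b + Q)                                 ≡⟨ sum-sq a b toList-↭ˣ ⟨
        sumℤ (map sq (x ⁺))                               ≡⟨ cong (sumℤ ∘ map sq) x⁺≡y⁺ ⟩
        sumℤ (map sq (y ⁺))                               ≡⟨ sum-sq (a - + n) (b + + n) toList-↭ʸ ⟩
        sq (a - + n) + (sq (b + + n) + Q)                 ≡⟨ ℤP.+-identityʳ _ ⟨
        sq (a - + n) + (sq (b + + n) + Q) + + 0           ∎)
        where open ≡-Reasoning
      0<D : + 0 < D
      0<D = subst₂ _<_ (cancel b (+ n)) (regroup a b (+ n)) (ℤP.+-monoˡ-< (ℤ.- + n - b) b+n<a)
        where
        cancel : ∀ b n → b + n + (ℤ.- n - b) ≡ + 0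
        cancel = solve-∀
        regroup : ∀ a b n → a + (ℤ.- n - b) ≡ a - n - b
        regroup = solve-∀
      sorted-differ : ¬ x ⁺ ≡ y ⁺
      sorted-differ x⁺≡y⁺ with ℤP.i*j≡0⇒i≡0∨j≡0 (+ n) (drop-vanishes x⁺≡y⁺)
      ... | inj₁ n≡0 = ℕP.<⇒≢ 1≤n (sym (ℤP.+-injective n≡0))
      ... | inj₂ D+D≡0 = ℤP.<-irrefl (sym D+D≡0) (ℤP.+-mono-< 0<D 0<D)

    tie⇒⁺≡ : b + + n ≡ a → x ⁺ ≡ y ⁺
    tie⇒⁺≡ b+n≡a = sort-↭⇒≡ (↭-trans toList-↭ˣ (↭-trans (↭-swap a b ↭-refl)
      (↭-sym (subst₂ (λ u v → toList y ↭ u ∷ v ∷ rest) a-n≡b b+n≡a toList-↭ʸ))))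
      where
      a-n≡b : a - + n ≡ b
      a-n≡b = trans (cong (_- + n) (sym b+n≡a)) (cancel b (+ n))
        where
        cancel : ∀ b n → b + n - n ≡ b
        cancel = solve-∀

    module _ (1≤p : 1 ℕ.≤ p) (p<q : p ℕ.< q) where
      private
        f = x ‼ℤ_
        g = y ‼ℤ_
        q≤N = proj₂ q∈

      Σ≤-step : ∀ k c → suc k ℕ.≤ N → suc k ≢ p → suc k ≢ q →
                Σ≤ g k + c ≡ Σ≤ f k → Σ≤ g (suc k) + c ≡ Σ≤ f (suc k)
      Σ≤-step k c k<N k≢p k≢q ih = begin
        Σ≤ g (suc k) + c              ≡⟨ cong (_+ c) (Σ≤-suc g k) ⟩
        Σ≤ g k + g (suc k) + c        ≡⟨ swap-last (Σ≤ g k) (g (suc k)) c ⟩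
        Σ≤ g k + c + g (suc k)        ≡⟨ cong₂ _+_ ih (elsewhere (suc k) (s≤s z≤n , k<N) k≢p k≢q) ⟩
        Σ≤ f k + f (suc k)            ≡⟨ Σ≤-suc f k ⟨
        Σ≤ f (suc k)                  ∎
        where
        open ≡-Reasoning
        swap-last : ∀ s u c → s + u + c ≡ s + c + u
        swap-last = solve-∀

      Σ≤-before : ∀ k → k ℕ.< p → Σ≤ g k + + 0 ≡ Σ≤ f k
      Σ≤-before zero _ = refl
      Σ≤-before (suc k) k<p = Σ≤-step k (+ 0) (ℕP.<⇒≤ (ℕP.<-trans k<p (ℕP.<-≤-trans p<q q≤N)))
        (ℕP.<⇒≢ k<p) (ℕP.<⇒≢ (ℕP.<-trans k<p p<q)) (Σ≤-before k (ℕP.<-trans (ℕP.n<1+n k) k<p))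

      Σ≤-between : ∀ k → p ℕ.≤ k → k ℕ.< q → Σ≤ g k + + n ≡ Σ≤ f k
      Σ≤-between zero p≤0 _ = ⊥-elim (ℕP.<-irrefl refl (ℕP.<-≤-trans 1≤p p≤0))
      Σ≤-between (suc k) p≤k k<q with suc k ℕ.≟ p
      ... | yes refl = begin
        Σ≤ g (suc k) + + n            ≡⟨ cong (_+ + n) (Σ≤-suc g k) ⟩
        Σ≤ g k + g (suc k) + + n      ≡⟨ cong (λ z → Σ≤ g k + z + + n) at-p ⟩
        Σ≤ g k + (f (suc k) - + n) + + n ≡⟨ restore (Σ≤ g k) (f (suc k)) (+ n) ⟩
        Σ≤ g k + + 0 + f (suc k)      ≡⟨ cong (_+ f (suc k)) (Σ≤-before k ℕP.≤-refl) ⟩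
        Σ≤ f k + f (suc k)            ≡⟨ Σ≤-suc f k ⟨
        Σ≤ f (suc k)                  ∎
        where
        open ≡-Reasoning
        restore : ∀ s u c → s + (u - c) + c ≡ s + + 0 + u
        restore = solve-∀
      ... | no k≢p = Σ≤-step k (+ n) (ℕP.<⇒≤ (ℕP.<-≤-trans k<q q≤N)) k≢p (ℕP.<⇒≢ k<q)
        (Σ≤-between k (ℕP.≤-pred (ℕP.≤∧≢⇒< p≤k (k≢p ∘ sym))) (ℕP.<-trans (ℕP.n<1+n k) k<q))

      Σ≤-after : ∀ k → q ℕ.≤ k → k ℕ.≤ N → Σ≤ g k + + 0 ≡ Σ≤ f k
      Σ≤-after zero q≤0 _ = ⊥-elim (ℕP.<-irrefl refl (ℕP.<-≤-trans (ℕP.<-≤-trans 1≤p (ℕP.<⇒≤ p<q)) q≤0))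
      Σ≤-after (suc k) q≤k k≤N with suc k ℕ.≟ q
      ... | yes refl = begin
        Σ≤ g (suc k) + + 0            ≡⟨ cong (_+ + 0) (Σ≤-suc g k) ⟩
        Σ≤ g k + g (suc k) + + 0      ≡⟨ cong (λ z → Σ≤ g k + z + + 0) at-q ⟩
        Σ≤ g k + (f (suc k) + + n) + + 0 ≡⟨ regroup (Σ≤ g k) (f (suc k)) (+ n) ⟩
        Σ≤ g k + + n + f (suc k)      ≡⟨ cong (_+ f (suc k)) (Σ≤-between k (ℕP.≤-pred p<q) ℕP.≤-refl) ⟩
        Σ≤ f k + f (suc k)            ≡⟨ Σ≤-suc f k ⟨
        Σ≤ f (suc k)                  ∎
        where
        open ≡-Reasoning
        regroup : ∀ s u c → s + (u + c) + + 0 ≡ s + c + u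
        regroup = solve-∀
      ... | no k≢q = Σ≤-step k (+ 0) k≤N (λ k≡p → ℕP.<-irrefl (sym k≡p) (ℕP.<-≤-trans p<q q≤k)) k≢q
        (Σ≤-after k (ℕP.≤-pred (ℕP.≤∧≢⇒< q≤k (k≢q ∘ sym))) (ℕP.<⇒≤ k≤N))

      Σ≤-decreases : ∀ k → k ℕ.≤ N → Σ≤ g k ≤ Σ≤ f k
      Σ≤-decreases k k≤N with k ℕ.<? p | k ℕ.<? q
      ... | yes k<p | _ = subst (Σ≤ g k ≤_) (Σ≤-before k k<p) (ℤP.i≤i+j (Σ≤ g k) (+ 0))
      ... | no k≮p | yes k<q = subst (Σ≤ g k ≤_) (Σ≤-between k (ℕP.≮⇒≥ k≮p) k<q) (ℤP.i≤i+j (Σ≤ g k) (+ n))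
      ... | no _ | no k≮q = subst (Σ≤ g k ≤_) (Σ≤-after k (ℕP.≮⇒≥ k≮q) k≤N) (ℤP.i≤i+j (Σ≤ g k) (+ 0))

      tie⇒≻ : 1 ℕ.≤ n → toList x ≻ toList y
      tie⇒≻ 1≤n = lists-differ , prefix-sums
        where
        lists-differ : ¬ toList x ≡ toList y
        lists-differ x≡y =
          ℕP.<⇒≢ 1≤n (sym (ℤP.+-injective (ℤP.neg-injective (sym (+-cancelˡ a (+ 0) (ℤ.- + n) a+0≡a-n)))))
          where
          a+0≡a-n : a + + 0 ≡ a - + n
          a+0≡a-n = begin
            a + + 0                ≡⟨ ℤP.+-identityʳ a ⟩
            a                      ≡⟨ cong (_‼ℤ p) (VecP.cast-is-id refl x) ⟨
            Vec.cast refl x ‼ℤ p   ≡⟨ cong (_‼ℤ p) (VecP.toList-injective refl x y x≡y) ⟩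
            y ‼ℤ p                 ≡⟨ at-p ⟩
            a - + n                ∎
            where open ≡-Reasoning
        prefix-sums : ∀ j → psum (toList y) j ≤ psum (toList x) j
        prefix-sums j = subst₂ _≤_
          (sym (trans (cong (λ l → psum l j) (toList-‼ℤ y)) (psum-positions g N j)))
          (sym (trans (cong (λ l → psum l j) (toList-‼ℤ x)) (psum-positions f N j)))
          (Σ≤-decreases (j ⊓ N) (ℕP.m⊓n≤n j N))

  transfer-⊳ : ∀ {N} {x y : Vec ℤ N} {p q n} → IsTransfer x y p q n → 1 ℕ.≤ n →
    x ‼ℤ q + + n < x ‼ℤ p ⊎ (x ‼ℤ q + + n ≡ x ‼ℤ p × p ℕ.< q) → x ⊳ y
  transfer-⊳ t 1≤n (inj₁ gap) = transfer-sumℤ t , inj₁ (gap⇒⁺≻ t 1≤n gap)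
  transfer-⊳ t 1≤n (inj₂ (tie , p<q)) =
    transfer-sumℤ t , inj₂ (tie⇒⁺≡ t tie , tie⇒≻ t (proj₁ (IsTransfer.p∈ t)) p<q 1≤n)


-- a ≺⟨ d ⟩ b encodes α̃_a + d < α̃_b and a ≼ b encodes α̃_a ≤ α̃_b, where α̃_i = v i − i υ:
-- since 0 < i υ < 1 at every position, integer shifts compare the parts and positions only break ties.
module TildeOrder (v : ℕ → ℕ) where
  open import Data.Nat using (ℕ; _+_; _≤_; _<_; _≟_; _<?_; _≤?_)
  import Data.Nat.Properties as ℕP
  open import Data.Product using (_×_; _,_)
  open import Data.Sum using (_⊎_; inj₁; inj₂)
  open import Data.Empty using (⊥-elim)
  open import Relation.Binary.PropositionalEquality
  open import Function using (_∘_)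
  open import Relation.Binary.Definitions using (tri<; tri≈; tri>)
  open import Relation.Nullary using (¬_; Dec)
  open import Relation.Nullary.Decidable using (_⊎-dec_; _×-dec_)

  infix 4 _≺⟨_⟩_ _≺_ _≼_ _≼?_

  _≺⟨_⟩_ : ℕ → ℕ → ℕ → Set
  a ≺⟨ d ⟩ b = d + v a < v b ⊎ (d + v a ≡ v b × b < a)

  _≺_ : ℕ → ℕ → Set
  a ≺ b = a ≺⟨ 0 ⟩ b

  _≼_ : ℕ → ℕ → Set
  a ≼ b = v a < v b ⊎ (v a ≡ v b × b ≤ a)

  ≺⟨_⟩? : ∀ d a b → Dec (a ≺⟨ d ⟩ b)
  ≺⟨ d ⟩? a b = (d + v a <? v b) ⊎-dec ((d + v a ≟ v b) ×-dec (b <? a))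

  _≼?_ : ∀ a b → Dec (a ≼ b)
  a ≼? b = (v a <? v b) ⊎-dec ((v a ≟ v b) ×-dec (b ≤? a))

  ≼-refl : ∀ {a} → a ≼ a
  ≼-refl = inj₂ (refl , ℕP.≤-refl)

  ≺⇒≼ : ∀ {a b} → a ≺ b → a ≼ b
  ≺⇒≼ (inj₁ va<vb) = inj₁ va<vb
  ≺⇒≼ (inj₂ (va≡vb , b<a)) = inj₂ (va≡vb , ℕP.<⇒≤ b<a)

  ≺⇒⋡ : ∀ {a b} → a ≺ b → ¬ b ≼ a
  ≺⇒⋡ (inj₁ va<vb) (inj₁ vb<va) = ℕP.<-asym va<vb vb<va
  ≺⇒⋡ (inj₁ va<vb) (inj₂ (vb≡va , _)) = ℕP.<⇒≢ va<vb (sym vb≡va)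
  ≺⇒⋡ (inj₂ (va≡vb , _)) (inj₁ vb<va) = ℕP.<⇒≢ vb<va (sym va≡vb)
  ≺⇒⋡ (inj₂ (_ , b<a)) (inj₂ (_ , a≤b)) = ℕP.<⇒≱ b<a a≤b

  ≺-≼-trans : ∀ {a b c} → a ≺ b → b ≼ c → a ≺ c
  ≺-≼-trans (inj₁ va<vb) (inj₁ vb<vc) = inj₁ (ℕP.<-trans va<vb vb<vc)
  ≺-≼-trans {a} (inj₁ va<vb) (inj₂ (vb≡vc , _)) = inj₁ (subst (v a <_) vb≡vc va<vb)
  ≺-≼-trans {c = c} (inj₂ (va≡vb , _)) (inj₁ vb<vc) = inj₁ (subst (_< v c) (sym va≡vb) vb<vc)
  ≺-≼-trans (inj₂ (va≡vb , b<a)) (inj₂ (vb≡vc , c≤b)) = inj₂ (trans va≡vb vb≡vc , ℕP.≤-<-trans c≤b b<a)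

  ≼-≺-trans : ∀ {a b c d} → a ≼ b → b ≺⟨ d ⟩ c → a ≺⟨ d ⟩ c
  ≼-≺-trans {d = d} (inj₁ va<vb) (inj₁ d+vb<vc) = inj₁ (ℕP.<-trans (ℕP.+-monoʳ-< d va<vb) d+vb<vc)
  ≼-≺-trans {a} {d = d} (inj₁ va<vb) (inj₂ (d+vb≡vc , _)) = inj₁ (subst (d + v a <_) d+vb≡vc (ℕP.+-monoʳ-< d va<vb))
  ≼-≺-trans {c = c} {d} (inj₂ (va≡vb , _)) (inj₁ d+vb<vc) = inj₁ (subst (λ z → d + z < v c) (sym va≡vb) d+vb<vc)
  ≼-≺-trans {d = d} (inj₂ (va≡vb , b≤a)) (inj₂ (d+vb≡vc , c<b)) =
    inj₂ (trans (cong (d +_) va≡vb) d+vb≡vc , ℕP.<-≤-trans c<b b≤a)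

  ≢⇒≺⊎≻ : ∀ {a b} → a ≢ b → a ≺ b ⊎ b ≺ a
  ≢⇒≺⊎≻ {a} {b} a≢b with ℕP.<-cmp (v a) (v b) | ℕP.<-cmp a b
  ... | tri< va<vb _ _ | _ = inj₁ (inj₁ va<vb)
  ... | tri> _ _ vb<va | _ = inj₂ (inj₁ vb<va)
  ... | tri≈ _ va≡vb _ | tri< a<b _ _ = inj₂ (inj₂ (sym va≡vb , a<b))
  ... | tri≈ _ _ _ | tri≈ _ a≡b _ = ⊥-elim (a≢b a≡b)
  ... | tri≈ _ va≡vb _ | tri> _ _ b<a = inj₁ (inj₂ (va≡vb , b<a))

  ≺-irrefl : ∀ {a} → ¬ a ≺ a
  ≺-irrefl a≺a = ≺⇒⋡ a≺a ≼-refl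

  ≺∧⊀⇒ : ∀ {j b d} → j ≺ b → ¬ j ≺⟨ d ⟩ b →
         (b < j × v b < d + v j × v j ≤ v b) ⊎ (j < b × v b ≤ d + v j × v j < v b)
  ≺∧⊀⇒ {j} {b} {d} j≺b j⊀b with ℕP.<-cmp b j
  ... | tri< b<j _ _ = inj₁ (b<j , close , below j≺b)
    where
    close : v b < d + v j
    close with ℕP.m≤n⇒m<n∨m≡n (ℕP.≮⇒≥ (j⊀b ∘ inj₁))
    ... | inj₁ vb<d+vj = vb<d+vj
    ... | inj₂ vb≡d+vj = ⊥-elim (j⊀b (inj₂ (sym vb≡d+vj , b<j)))
    below : j ≺ b → v j ≤ v b
    below (inj₁ vj<vb) = ℕP.<⇒≤ vj<vb
    below (inj₂ (vj≡vb , _)) = ℕP.≤-reflexive vj≡vb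
  ... | tri≈ _ refl _ = ⊥-elim (≺-irrefl j≺b)
  ... | tri> _ _ j<b = inj₂ (j<b , ℕP.≮⇒≥ (j⊀b ∘ inj₁) , strictly-below j≺b)
    where
    strictly-below : j ≺ b → v j < v b
    strictly-below (inj₁ vj<vb) = vj<vb
    strictly-below (inj₂ (_ , b<j)) = ⊥-elim (ℕP.<-asym b<j j<b)


module AlphaTilde where
  open import Data.Nat as ℕ using (ℕ; suc; s≤s)
  import Data.Nat.Properties as ℕP
  open import Data.Nat.Tactic.RingSolver as ℕSolver using ()
  open import Data.Integer as ℤ using (ℤ; +_)
  import Data.Integer.Properties as ℤP
  open import Data.Integer.Tactic.RingSolver using (solve-∀)
  open import Data.Rational as ℚ using (ℚ)
  import Data.Rational.Properties as ℚP
  open import Data.Rational.Unnormalised as ℚᵘ using (ℚᵘ; mkℚᵘ; ↥_; ↧_; *<*)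
  import Data.Rational.Unnormalised.Properties as ℚᵘP
  open import Relation.Binary.PropositionalEquality
  open import Relation.Binary.Definitions using (tri<; tri≈; tri>)
  open import Data.Product using (_×_; _,_)
  open import Data.Sum using (_⊎_; inj₁; inj₂)
  open import Data.Empty using (⊥-elim)
  open import Data.Vec using (Vec)

  module _ (N : ℕ) where
    private
      M = suc N

    tilde : ℕ → ℕ → ℚ
    tilde x a = (+ x ℚ./ 1) ℚ.- ((+ a ℚ./ 1) ℚ.* (+ 1 ℚ./ M))

    private
      tildeᵘ : ℕ → ℕ → ℚᵘ
      tildeᵘ x a = mkℚᵘ (+ x) 0 ℚᵘ.- (mkℚᵘ (+ a) 0 ℚᵘ.* mkℚᵘ (+ 1) N)

      shiftedᵘ : ℕ → ℕ → ℕ → ℕ → ℚᵘ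
      shiftedᵘ y b c d = tildeᵘ y b ℚᵘ.- (mkℚᵘ (+ c) 0 ℚᵘ.* mkℚᵘ (+ d) 0)

      toℚᵘ-/ : ∀ i d → ℚ.toℚᵘ (i ℚ./ suc d) ℚᵘ.≃ mkℚᵘ i d
      toℚᵘ-/ i d = ℚP.toℚᵘ-fromℚᵘ (mkℚᵘ i d)

      toℚᵘ-homo-− : ∀ p q → ℚ.toℚᵘ (p ℚ.- q) ℚᵘ.≃ ℚ.toℚᵘ p ℚᵘ.- ℚ.toℚᵘ q
      toℚᵘ-homo-− p q =
        ℚᵘP.≃-trans (ℚP.toℚᵘ-homo-+ p (ℚ.- q)) (ℚᵘP.+-congʳ (ℚ.toℚᵘ p) (ℚP.toℚᵘ-homo‿- q))

      toℚᵘ-product : ∀ i j → ℚ.toℚᵘ ((i ℚ./ 1) ℚ.* (+ j ℚ./ 1)) ℚᵘ.≃ mkℚᵘ i 0 ℚᵘ.* mkℚᵘ (+ j) 0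
      toℚᵘ-product i j =
        ℚᵘP.≃-trans (ℚP.toℚᵘ-homo-* (i ℚ./ 1) (+ j ℚ./ 1)) (ℚᵘP.*-cong (toℚᵘ-/ i 0) (toℚᵘ-/ (+ j) 0))

      toℚᵘ-tilde : ∀ x a → ℚ.toℚᵘ (tilde x a) ℚᵘ.≃ tildeᵘ x a
      toℚᵘ-tilde x a = ℚᵘP.≃-trans (toℚᵘ-homo-− (+ x ℚ./ 1) _) (ℚᵘP.+-cong (toℚᵘ-/ (+ x) 0)
        (ℚᵘP.-‿cong (ℚᵘP.≃-trans (ℚP.toℚᵘ-homo-* (+ a ℚ./ 1) (+ 1 ℚ./ M))
                                 (ℚᵘP.*-cong (toℚᵘ-/ (+ a) 0) (toℚᵘ-/ (+ 1) N)))))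

      toℚᵘ-shifted : ∀ y b c d → ℚ.toℚᵘ (tilde y b ℚ.- ((+ c ℚ./ 1) ℚ.* (+ d ℚ./ 1))) ℚᵘ.≃ shiftedᵘ y b c d
      toℚᵘ-shifted y b c d = ℚᵘP.≃-trans (toℚᵘ-homo-− (tilde y b) _)
        (ℚᵘP.+-cong (toℚᵘ-tilde y b) (ℚᵘP.-‿cong (toℚᵘ-product (+ c) d)))

      ↧-tildeᵘ : ∀ x a → ↧ tildeᵘ x a ≡ + M
      ↧-tildeᵘ x a = cong (λ z → + suc z) (trans (ℕP.+-identityʳ _) (ℕP.+-identityʳ _))

      ↧-shiftedᵘ : ∀ y b c d → ↧ shiftedᵘ y b c d ≡ + M
      ↧-shiftedᵘ y b c d = cong (λ z → + suc z) (simplify N)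
        where
        simplify : ∀ N → (N ℕ.+ 0 ℕ.* suc N ℕ.+ 0 ℕ.* suc (N ℕ.+ 0 ℕ.* suc N)) ℕ.* 1 ≡ N
        simplify = ℕSolver.solve-∀

    tilde<shifted⇒ : ∀ x a y b c d → tilde x a ℚ.< tilde y b ℚ.- ((+ c ℚ./ 1) ℚ.* (+ d ℚ./ 1)) →
                     (c ℕ.* d ℕ.+ x) ℕ.* M ℕ.+ b ℕ.< y ℕ.* M ℕ.+ a
    tilde<shifted⇒ x a y b c d lt = ℤP.drop‿+<+ (subst₂ ℤ._<_ (sym lhs) (sym rhs) moved)
      where
      X = + x ; A = + a ; Y = + y ; B = + b ; C = + c ; D = + d ; m = + M
      crossed : ↥ tildeᵘ x a ℤ.* ↧ shiftedᵘ y b c d ℤ.< ↥ shiftedᵘ y b c d ℤ.* ↧ tildeᵘ x a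
      crossed with ℚᵘP.<-respʳ-≃ (toℚᵘ-shifted y b c d) (ℚᵘP.<-respˡ-≃ (toℚᵘ-tilde x a) (ℚP.toℚᵘ-mono-< lt))
      ... | *<* p = p
      -- the numerators as ℚᵘ computes them; both denominators are N+1
      L = X ℤ.* (+ 1 ℤ.* m) ℤ.+ ℤ.- (A ℤ.* + 1) ℤ.* + 1
      R = (Y ℤ.* (+ 1 ℤ.* m) ℤ.+ ℤ.- (B ℤ.* + 1) ℤ.* + 1) ℤ.* + 1 ℤ.+ ℤ.- (C ℤ.* D) ℤ.* m
      scaled : L ℤ.* m ℤ.< R ℤ.* m
      scaled = subst₂ ℤ._<_ (cong (L ℤ.*_) (↧-shiftedᵘ y b c d))
        (cong₂ (λ d₁ d₂ → ((Y ℤ.* (+ 1 ℤ.* m) ℤ.+ ℤ.- (B ℤ.* + 1) ℤ.* + 1) ℤ.* + 1 ℤ.+ ℤ.- (C ℤ.* D) ℤ.* d₁)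
                          ℤ.* d₂)
          (↧-tildeᵘ y b) (↧-tildeᵘ x a)) crossed
      moved : (C ℤ.* D ℤ.+ X) ℤ.* m ℤ.+ B ℤ.< Y ℤ.* m ℤ.+ A
      moved = subst₂ ℤ._<_ (regroupˡ X A B C D m) (regroupʳ Y A B C D m)
        (ℤP.+-monoˡ-< (A ℤ.+ B ℤ.+ C ℤ.* D ℤ.* m) (ℤP.*-cancelʳ-<-nonNeg {L} {R} m scaled))
        where
        regroupˡ : ∀ X A B C D m → X ℤ.* (+ 1 ℤ.* m) ℤ.+ ℤ.- (A ℤ.* + 1) ℤ.* + 1 ℤ.+ (A ℤ.+ B ℤ.+ C ℤ.* D ℤ.* m) ≡
                                   (C ℤ.* D ℤ.+ X) ℤ.* m ℤ.+ B
        regroupˡ = solve-∀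
        regroupʳ : ∀ Y A B C D m →
                   (Y ℤ.* (+ 1 ℤ.* m) ℤ.+ ℤ.- (B ℤ.* + 1) ℤ.* + 1) ℤ.* + 1 ℤ.+ ℤ.- (C ℤ.* D) ℤ.* m
                     ℤ.+ (A ℤ.+ B ℤ.+ C ℤ.* D ℤ.* m) ≡ Y ℤ.* m ℤ.+ A
        regroupʳ = solve-∀
      lhs : + ((c ℕ.* d ℕ.+ x) ℕ.* M ℕ.+ b) ≡ (C ℤ.* D ℤ.+ X) ℤ.* m ℤ.+ B
      lhs = trans (ℤP.pos-+ _ b) (cong (ℤ._+ B) (trans (ℤP.pos-* (c ℕ.* d ℕ.+ x) M)
              (cong (ℤ._* m) (trans (ℤP.pos-+ (c ℕ.* d) x) (cong (ℤ._+ X) (ℤP.pos-* c d))))))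
      rhs : + (y ℕ.* M ℕ.+ a) ≡ Y ℤ.* m ℤ.+ A
      rhs = trans (ℤP.pos-+ (y ℕ.* M) a) (cong (ℤ._+ A) (ℤP.pos-* y M))

  radix-<⇒lex : ∀ {M x y a b} → x ℕ.* M ℕ.+ a ℕ.< y ℕ.* M ℕ.+ b → b ℕ.< M → x ℕ.< y ⊎ (x ≡ y × a ℕ.< b)
  radix-<⇒lex {M} {x} {y} {a} {b} lt b<M with ℕP.<-cmp x y
  ... | tri< x<y _ _ = inj₁ x<y
  ... | tri≈ _ refl _ = inj₂ (refl , ℕP.+-cancelˡ-< (x ℕ.* M) a b lt)
  ... | tri> _ _ y<x = ⊥-elim (ℕP.<-asym lt (begin-strict
    y ℕ.* M ℕ.+ b   <⟨ ℕP.+-monoʳ-< (y ℕ.* M) b<M ⟩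
    y ℕ.* M ℕ.+ M   ≡⟨ ℕP.+-comm (y ℕ.* M) M ⟩
    suc y ℕ.* M     ≤⟨ ℕP.*-monoˡ-≤ M y<x ⟩
    x ℕ.* M         ≤⟨ ℕP.m≤m+n (x ℕ.* M) a ⟩
    x ℕ.* M ℕ.+ a   ∎))
    where open ℕP.≤-Reasoning

  αtil<⇒≺ : ∀ {N} (α : Vec ℕ N) {u p} c d → u ℕ.≤ N →
            αtil α u ℚ.< αtil α p ℚ.- ((+ c ℚ./ 1) ℚ.* (+ d ℚ./ 1)) → TildeOrder._≺⟨_⟩_ (α ‼_) u (c ℕ.* d) p
  αtil<⇒≺ {N} α {u} {p} c d u≤N lt = radix-<⇒lex (tilde<shifted⇒ N (α ‼ u) u (α ‼ p) p c d lt) (s≤s u≤N)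


module Ranks where
  open import Data.Nat as ℕ using (ℕ; suc; _+_; _∸_; _≤_; _<_; s≤s; z≤n; _≟_)
  import Data.Nat.Properties as ℕP
  open import Data.Bool using (Bool; T; _∧_)
  open import Data.Bool.Properties using (T-∧; T?)
  import Data.List.Properties as ListP
  open import Data.List.Relation.Unary.Any as Any using (Any)
  open import Data.Vec using (Vec)
  open import Data.Product using (_×_; _,_; proj₁; proj₂)
  open import Data.Sum using (_⊎_; inj₁; inj₂)
  open import Data.Empty using (⊥; ⊥-elim)
  open import Function using (_∘_; Equivalence)
  open import Relation.Binary.PropositionalEquality
  open import Relation.Nullary using (yes; no; ¬_)
  open import Relation.Unary.Properties using (_∪?_)
  open Counting
  open Positions using (InRange; ∈-positions⁺; ∈-positions⁻; length-positions)
  open import Data.List.Membership.Propositional using (_∈_)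

  module _ {N} (α : Vec ℕ N) where
    open TildeOrder (α ‼_)

    rank≡count : ∀ a → rank α a ≡ count⟨ a ≼?_ ⟩ (positions N)
    rank≡count a = trans (sym (count-∪ greater? equal? (λ {j} → disjoint j) (positions N)))
      (count-≐ (greater? ∪? equal?) (a ≼?_) (positions N) (λ {j} → to j) (λ {j} → from j))
      where
      greater? = λ j → T? ((α ‼ a) ℕ.<ᵇ (α ‼ j))
      equal? = λ j → T? ((j ℕ.≤ᵇ a) ∧ ((α ‼ j) ℕ.≡ᵇ (α ‼ a)))
      decode : ∀ j → T ((j ℕ.≤ᵇ a) ∧ ((α ‼ j) ℕ.≡ᵇ (α ‼ a))) → j ≤ a × α ‼ j ≡ α ‼ a
      decode j t with Equivalence.to T-∧ t
      ... | j≤a , eq = ℕP.≤ᵇ⇒≤ j a j≤a , ℕP.≡ᵇ⇒≡ _ _ eq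
      disjoint : ∀ j → T ((α ‼ a) ℕ.<ᵇ (α ‼ j)) → T ((j ℕ.≤ᵇ a) ∧ ((α ‼ j) ℕ.≡ᵇ (α ‼ a))) → ⊥
      disjoint j gt eq = ℕP.<⇒≢ (ℕP.<ᵇ⇒< _ _ gt) (sym (proj₂ (decode j eq)))
      to : ∀ j → T ((α ‼ a) ℕ.<ᵇ (α ‼ j)) ⊎ T ((j ℕ.≤ᵇ a) ∧ ((α ‼ j) ℕ.≡ᵇ (α ‼ a))) → a ≼ j
      to j (inj₁ gt) = inj₁ (ℕP.<ᵇ⇒< _ _ gt)
      to j (inj₂ eq) with decode j eq
      ... | j≤a , αj≡αa = inj₂ (sym αj≡αa , j≤a)
      from : ∀ j → a ≼ j → T ((α ‼ a) ℕ.<ᵇ (α ‼ j)) ⊎ T ((j ℕ.≤ᵇ a) ∧ ((α ‼ j) ℕ.≡ᵇ (α ‼ a)))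
      from j (inj₁ gt) = inj₁ (ℕP.<⇒<ᵇ gt)
      from j (inj₂ (αa≡αj , j≤a)) =
        inj₂ (Equivalence.from T-∧ (ℕP.≤⇒≤ᵇ j≤a , ℕP.≡⇒≡ᵇ _ _ (sym αa≡αj)))

    rank-≥1 : ∀ {a} → InRange N a → 1 ≤ rank α a
    rank-≥1 {a} a∈ = subst (1 ≤_) (sym (rank≡count a))
      (ListP.filter-some (a ≼?_) (Any.map (λ a≡j → subst (a ≼_) a≡j ≼-refl) (∈-positions⁺ a∈)))

    rank-≤ : ∀ a → rank α a ≤ N
    rank-≤ a = subst (_≤ N) (sym (rank≡count a))
      (subst (count⟨ a ≼?_ ⟩ (positions N) ≤_) (length-positions N) (ListP.length-filter (a ≼?_) (positions N)))

    rank-< : ∀ {a b} → InRange N b → b ≺ a → rank α a < rank α b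
    rank-< {a} {b} b∈ b≺a = subst₂ _<_ (sym (rank≡count a)) (sym (rank≡count b)) (begin-strict
      count⟨ a ≼?_ ⟩ pos                          <⟨ ℕP.m<m+n _ (ℕP.≤-reflexive (sym (count-positions-≟ b∈))) ⟩
      count⟨ a ≼?_ ⟩ pos + count⟨ _≟ b ⟩ pos      ≡⟨ count-∪ (a ≼?_) (_≟ b) b∉above-a pos ⟨
      count⟨ (a ≼?_) ∪? (_≟ b) ⟩ pos              ≤⟨ count-mono ((a ≼?_) ∪? (_≟ b)) (b ≼?_) pos (λ _ → above-b) ⟩
      count⟨ b ≼?_ ⟩ pos                          ∎)
      where
      open ℕP.≤-Reasoning
      pos = positions N
      b∉above-a : ∀ {j} → a ≼ j → j ≡ b → ⊥
      b∉above-a a≼b refl = ≺⇒⋡ b≺a a≼b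
      above-b : ∀ {j} → a ≼ j ⊎ j ≡ b → b ≼ j
      above-b (inj₁ a≼j) = ≺⇒≼ (≺-≼-trans b≺a a≼j)
      above-b (inj₂ refl) = ≼-refl

    rank-injective : ∀ {a b} → InRange N a → InRange N b → rank α a ≡ rank α b → a ≡ b
    rank-injective {a} {b} a∈ b∈ ra≡rb with a ≟ b
    ... | yes a≡b = a≡b
    ... | no a≢b with ≢⇒≺⊎≻ a≢b
    ...   | inj₁ a≺b = ⊥-elim (ℕP.<⇒≢ (rank-< a∈ a≺b) (sym ra≡rb))
    ...   | inj₂ b≺a = ⊥-elim (ℕP.<⇒≢ (rank-< b∈ b≺a) ra≡rb)

  legʳ legˡ : ∀ {N} → Vec ℕ N → ℕ → ℕ → ℕ → Bool
  legʳ α i j l = (i ℕ.<ᵇ l) ∧ ((j ℕ.≤ᵇ (α ‼ l)) ∧ ((α ‼ l) ℕ.≤ᵇ (α ‼ i)))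
  legˡ α i j l = (l ℕ.<ᵇ i) ∧ ((j ℕ.≤ᵇ suc (α ‼ l)) ∧ (suc (α ‼ l) ℕ.≤ᵇ (α ‼ i)))

  T-∧₃ : ∀ {x y z} → T x → T y → T z → T (x ∧ (y ∧ z))
  T-∧₃ tx ty tz = Equivalence.from T-∧ (tx , Equivalence.from T-∧ (ty , tz))

  period : ∀ {N} → Vec ℕ N → (ℕ → ℕ) → ℕ → ℕ
  period α w n = suc (leg α (w 1) (suc (α ‼ w 1) ∸ n))

  IsRanking : ∀ {N} → Vec ℕ N → (ℕ → ℕ) → Set
  IsRanking {N} α w = ∀ i → 1 ≤ i → i ≤ N → (1 ≤ w i) × (w i ≤ N) × (rank α (w i) ≡ i)

  module Ranking {N} {α : Vec ℕ N} {w : ℕ → ℕ} (ranking : IsRanking α w) where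
    open TildeOrder (α ‼_)

    w-inRange : ∀ {i} → InRange N i → InRange N (w i)
    w-inRange {i} (1≤i , i≤N) with ranking i 1≤i i≤N
    ... | 1≤wi , wi≤N , _ = 1≤wi , wi≤N

    rank-w : ∀ {i} → InRange N i → rank α (w i) ≡ i
    rank-w {i} (1≤i , i≤N) = proj₂ (proj₂ (ranking i 1≤i i≤N))

    w-injective : ∀ {i j} → InRange N i → InRange N j → w i ≡ w j → i ≡ j
    w-injective i∈ j∈ wi≡wj = trans (sym (rank-w i∈)) (trans (cong (rank α) wi≡wj) (rank-w j∈))

    w-rank : ∀ {a} → InRange N a → w (rank α a) ≡ a
    w-rank {a} a∈ = rank-injective α (w-inRange r∈) a∈ (rank-w r∈)
      where r∈ = rank-≥1 α a∈ , rank-≤ α a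

    w-antitone : ∀ {i j} → 1 ≤ i → i < j → j ≤ N → w j ≺ w i
    w-antitone {i} {j} 1≤i i<j j≤N with ≢⇒≺⊎≻ (ℕP.<⇒≢ i<j ∘ w-injective i∈ j∈)
      where
      i∈ = 1≤i , ℕP.≤-trans (ℕP.<⇒≤ i<j) j≤N
      j∈ = ℕP.≤-trans 1≤i (ℕP.<⇒≤ i<j) , j≤N
    ... | inj₂ wj≺wi = wj≺wi
    ... | inj₁ wi≺wj = ⊥-elim (ℕP.<-asym i<j (subst₂ _<_ (rank-w j∈) (rank-w i∈) (rank-< α (w-inRange i∈) wi≺wj)))
      where
      i∈ = 1≤i , ℕP.≤-trans (ℕP.<⇒≤ i<j) j≤N
      j∈ = ℕP.≤-trans 1≤i (ℕP.<⇒≤ i<j) , j≤N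

    below-w1 : ∀ {l} → InRange N l → l ≢ w 1 → l ≺ w 1
    below-w1 {l} l∈ l≢w1 = subst (_≺ w 1) (w-rank l∈) (w-antitone ℕP.≤-refl 1<rank (rank-≤ α l))
      where
      1<rank : 1 < rank α l
      1<rank = ℕP.≤∧≢⇒< (rank-≥1 α l∈) (λ 1≡r → l≢w1 (trans (sym (w-rank l∈)) (cong w (sym 1≡r))))

    near-top⇒leg : ∀ n {j} → InRange N j → j ≢ w 1 → ¬ j ≺⟨ n ⟩ w 1 →
                   T (legʳ α (w 1) (suc (α ‼ w 1) ∸ n) j) ⊎ T (legˡ α (w 1) (suc (α ‼ w 1) ∸ n) j)
    near-top⇒leg n {j} j∈ j≢w1 j⊀w1 with ≺∧⊀⇒ (below-w1 j∈ j≢w1) j⊀w1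
    ... | inj₁ (b<j , αb<n+αj , αj≤αb) =
      inj₁ (T-∧₃ (ℕP.<⇒<ᵇ b<j) (ℕP.≤⇒≤ᵇ (ℕP.m≤n+o⇒m∸n≤o (suc (α ‼ w 1)) n αb<n+αj))
                 (ℕP.≤⇒≤ᵇ αj≤αb))
    ... | inj₂ (j<b , αb≤n+αj , αj<αb) =
      inj₂ (T-∧₃ (ℕP.<⇒<ᵇ j<b) (ℕP.≤⇒≤ᵇ (ℕP.m≤n+o⇒m∸n≤o (suc (α ‼ w 1)) n n+1+αj))
                 (ℕP.≤⇒≤ᵇ αj<αb))
      where
      n+1+αj : suc (α ‼ w 1) ≤ n + suc (α ‼ j)
      n+1+αj = subst (suc (α ‼ w 1) ≤_) (sym (ℕP.+-suc n (α ‼ j))) (s≤s αb≤n+αj)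

    -- The (m+1)-st largest α̃ lies more than n below the largest: otherwise the m+1 positions
    -- with α̃ at least α̃_{w(m+1)} would all be w(1) or in its leg, which has only m − 1 cells.
    leg-gap : ∀ n → period α w n + 1 ≤ N → w (period α w n + 1) ≺⟨ n ⟩ w 1
    leg-gap n m+1≤N with ≺⟨ n ⟩? (w (period α w n + 1)) (w 1)
    ... | yes gap = gap
    ... | no no-gap = ⊥-elim (ℕP.<-irrefl refl (begin-strict
      m                                            <⟨ ℕP.m<m+n m (s≤s z≤n) ⟩
      m + 1                                        ≡⟨ rank-w m+1∈ ⟨
      rank α c                                     ≡⟨ rank≡count α c ⟩
      count⟨ c ≼?_ ⟩ pos                           ≤⟨ count-mono (c ≼?_) ((_≟ b) ∪? (legʳ? ∪? legˡ?)) pos in-leg ⟩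
      count⟨ (_≟ b) ∪? (legʳ? ∪? legˡ?) ⟩ pos         ≡⟨ count-∪ (_≟ b) (legʳ? ∪? legˡ?) b∉leg pos ⟩
      count⟨ _≟ b ⟩ pos + count⟨ legʳ? ∪? legˡ? ⟩ pos ≡⟨ cong₂ _+_ (count-positions-≟ (w-inRange 1∈))
                                                          (count-∪ legʳ? legˡ? (λ {j} → legs-disjoint j) pos) ⟩
      m                                            ∎))
      where
      open ℕP.≤-Reasoning
      m = period α w n
      b = w 1
      c = w (m + 1)
      pos = positions N
      legʳ? = λ l → T? (legʳ α b (suc (α ‼ b) ∸ n) l)
      legˡ? = λ l → T? (legˡ α b (suc (α ‼ b) ∸ n) l)
      m+1∈ : InRange N (m + 1)
      m+1∈ = ℕP.≤-trans (s≤s z≤n) (ℕP.≤-reflexive (ℕP.+-comm 1 m)) , m+1≤N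
      1∈ : InRange N 1
      1∈ = s≤s z≤n , ℕP.≤-trans (s≤s z≤n) m+1≤N
      legs-disjoint : ∀ j → T (legʳ α b (suc (α ‼ b) ∸ n) j) → T (legˡ α b (suc (α ‼ b) ∸ n) j) → ⊥
      legs-disjoint j t₁ t₂ =
        ℕP.<-asym (ℕP.<ᵇ⇒< b j (proj₁ (Equivalence.to T-∧ t₁))) (ℕP.<ᵇ⇒< j b (proj₁ (Equivalence.to T-∧ t₂)))
      b∉leg : ∀ {j} → j ≡ b → T (legʳ α b (suc (α ‼ b) ∸ n) j) ⊎ T (legˡ α b (suc (α ‼ b) ∸ n) j) → ⊥
      b∉leg refl (inj₁ t) = ℕP.<-irrefl refl (ℕP.<ᵇ⇒< b b (proj₁ (Equivalence.to T-∧ t)))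
      b∉leg refl (inj₂ t) = ℕP.<-irrefl refl (ℕP.<ᵇ⇒< b b (proj₁ (Equivalence.to T-∧ t)))
      in-leg : ∀ {j} → j ∈ pos → c ≼ j →
               j ≡ b ⊎ (T (legʳ α b (suc (α ‼ b) ∸ n) j) ⊎ T (legˡ α b (suc (α ‼ b) ∸ n) j))
      in-leg {j} j∈ c≼j with j ≟ b
      ... | yes j≡b = inj₁ j≡b
      ... | no j≢b = inj₂ (near-top⇒leg n (∈-positions⁻ j∈) j≢b (no-gap ∘ ≼-≺-trans c≼j))


module Residues where
  open import Data.Nat as ℕ using (ℕ; suc; _+_; _*_; _∸_; _≤_; _<_; _≤ᵇ_; _≟_; NonZero)
  import Data.Nat.Properties as ℕP
  open import Data.Nat.DivMod
  open import Data.Bool using (true; false; T; if_then_else_)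
  open import Data.Bool.Properties using (T-≡)
  open import Data.Unit using (tt)
  open import Data.Product using (_×_; _,_)
  open import Data.Sum using (_⊎_; inj₁; inj₂)
  open import Data.Empty using (⊥-elim)
  open import Relation.Binary.PropositionalEquality
  open import Relation.Nullary using (yes; no; ¬_)
  open import Function using (_∘_; Equivalence)

  divMod-unique : ∀ {s q r m} .{{_ : NonZero m}} → r < m → s ≡ r + q * m → s / m ≡ q × s % m ≡ r
  divMod-unique {q = q} {r} {m} r<m refl = quotient , remainder
    where
    remainder : (r + q * m) % m ≡ r
    remainder = trans ([m+kn]%n≡m%n r q m) (m<n⇒m%n≡m r<m)
    no-carry : r % m + q * m % m < m
    no-carry = subst (_< m) (sym (trans (cong₂ _+_ (m<n⇒m%n≡m r<m) (m*n%n≡0 q m)) (ℕP.+-identityʳ r))) r<m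
    quotient : (r + q * m) / m ≡ q
    quotient = trans (+-distrib-/ r (q * m) no-carry) (cong₂ _+_ (m<n⇒m/n≡0 r<m) (m*n/n≡m q m))

  ¬T⇒≡false : ∀ {b} → ¬ T b → b ≡ false
  ¬T⇒≡false {true} ¬t = ⊥-elim (¬t tt)
  ¬T⇒≡false {false} _ = refl

  ≤ᵇ-true : ∀ {i r} → i ≤ r → (i ≤ᵇ r) ≡ true
  ≤ᵇ-true = Equivalence.to T-≡ ∘ ℕP.≤⇒≤ᵇ

  ≤ᵇ-false : ∀ {i r} → r < i → (i ≤ᵇ r) ≡ false
  ≤ᵇ-false {i} {r} r<i = ¬T⇒≡false (ℕP.<⇒≱ r<i ∘ ℕP.≤ᵇ⇒≤ i r)

  module _ (m : ℕ) .{{_ : NonZero m}} where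

    suc-divMod : ∀ s → (suc (s % m) < m × suc s / m ≡ s / m × suc s % m ≡ suc (s % m)) ⊎
                       (suc (s % m) ≡ m × suc s / m ≡ suc (s / m) × suc s % m ≡ 0)
    suc-divMod s with ℕP.m≤n⇒m<n∨m≡n (m%n<n s m)
    ... | inj₁ r+1<m = inj₁ (r+1<m , divMod-unique r+1<m (cong suc (m≡m%n+[m/n]*n s m)))
    ... | inj₂ r+1≡m = inj₂ (r+1≡m , divMod-unique (ℕ.>-nonZero⁻¹ m) (begin
      suc s                      ≡⟨ cong suc (m≡m%n+[m/n]*n s m) ⟩
      suc (s % m) + s / m * m    ≡⟨ cong (_+ s / m * m) r+1≡m ⟩
      m + s / m * m              ∎))
      where open ≡-Reasoning

    -- #{ i′ ∈ [1, s] : ((i′ − 1) mod m) + 1 = i } for 1 ≤ i ≤ m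
    hits : ℕ → ℕ → ℕ
    hits s i = s / m + (if i ≤ᵇ s % m then 1 else 0)

    hits-src : ∀ s → hits s (suc (s % m)) ≡ s / m
    hits-src s = trans (cong (λ b → s / m + (if b then 1 else 0)) (≤ᵇ-false (ℕP.n<1+n (s % m)))) (ℕP.+-identityʳ _)

    hits-suc-src : ∀ s → hits (suc s) (suc (s % m)) ≡ suc (hits s (suc (s % m)))
    hits-suc-src s with suc-divMod s
    ... | inj₁ (_ , q≡ , r≡) rewrite q≡ | r≡ | ≤ᵇ-true (ℕP.≤-refl {suc (s % m)}) | hits-src s = ℕP.+-comm (s / m) 1
    ... | inj₂ (_ , q≡ , r≡) rewrite q≡ | r≡ | hits-src s = ℕP.+-identityʳ (suc (s / m))

    hits-suc-other : ∀ s {i} → 1 ≤ i → i ≤ m → i ≢ suc (s % m) → hits (suc s) i ≡ hits s i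
    hits-suc-other s {i} 1≤i i≤m i≢r+1 with suc-divMod s
    ... | inj₁ (_ , q≡ , r≡) rewrite q≡ | r≡ with i ℕ.≤? s % m
    ...   | yes i≤r rewrite ≤ᵇ-true i≤r | ≤ᵇ-true (ℕP.m≤n⇒m≤1+n i≤r) = refl
    ...   | no i≰r rewrite ≤ᵇ-false (ℕP.≰⇒> i≰r)
                         | ≤ᵇ-false (ℕP.≤∧≢⇒< (ℕP.≰⇒> i≰r) (i≢r+1 ∘ sym)) = refl
    hits-suc-other s {i} 1≤i i≤m i≢r+1 | inj₂ (r+1≡m , q≡ , r≡) rewrite q≡ | r≡ | ≤ᵇ-false 1≤i
      | ≤ᵇ-true (ℕP.≤-pred (subst (i <_) (sym r+1≡m) (ℕP.≤∧≢⇒< i≤m (λ i≡m → i≢r+1 (trans i≡m (sym r+1≡m)))))) =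
      trans (ℕP.+-identityʳ _) (ℕP.+-comm 1 (s / m))

    hits-final : ∀ {T i} → 1 ≤ T → 1 ≤ i → i ≤ m →
                 let t = suc ((T ∸ 1) % m) ; k = (T ∸ t) / m in
                 (i ≤ t → hits T i ≡ k + 1) × (t < i → hits T i ≡ k)
    hits-final {suc T′} {i} _ 1≤i i≤m = at-most-t , beyond-t
      where
      r = T′ % m
      k≡q : (T′ ∸ r) / m ≡ T′ / m
      k≡q = trans (cong (λ z → (z ∸ r) / m) (m≡m%n+[m/n]*n T′ m))
                  (trans (cong (_/ m) (ℕP.m+n∸m≡n r (T′ / m * m))) (m*n/n≡m (T′ / m) m))
      at-most-t : i ≤ suc r → hits (suc T′) i ≡ (T′ ∸ r) / m + 1
      at-most-t i≤r+1 with i ≟ suc r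
      ... | yes refl = trans (hits-suc-src T′) (trans (cong suc (hits-src T′)) (trans (ℕP.+-comm 1 _) (cong (_+ 1) (sym k≡q))))
      ... | no i≢r+1 rewrite hits-suc-other T′ 1≤i i≤m i≢r+1 | ≤ᵇ-true (ℕP.≤-pred (ℕP.≤∧≢⇒< i≤r+1 i≢r+1)) =
        cong (_+ 1) (sym k≡q)
      beyond-t : suc r < i → hits (suc T′) i ≡ (T′ ∸ r) / m
      beyond-t r+1<i rewrite hits-suc-other T′ 1≤i i≤m (ℕP.>⇒≢ r+1<i) | ≤ᵇ-false (ℕP.<-trans (ℕP.n<1+n r) r+1<i) =
        trans (ℕP.+-identityʳ _) (sym k≡q)


module Lookups where
  open import Data.Nat using (ℕ; zero; suc; _<_; s≤s; z≤n; _≡ᵇ_)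
  import Data.Nat.Properties as ℕP
  open import Data.Integer using (ℤ; +_; _+_; _-_; _*_)
  import Data.Integer.Properties as ℤP
  open import Data.Bool using (if_then_else_)
  open import Data.Bool.Properties using (T-≡)
  open import Data.Fin as Fin using (Fin; toℕ; fromℕ<)
  import Data.Fin.Properties as FinP
  open import Data.List as List using (List; []; _∷_)
  open import Data.Vec as Vec using (Vec; []; _∷_; zipWith; tabulate; replicate)
  open import Data.Product using (_,_)
  open import Relation.Binary.PropositionalEquality
  open import Function using (_∘_; Equivalence)
  open Positions using (InRange; Σ≤)
  open Residues using (¬T⇒≡false)

  private
    lk-zipWith : ∀ {n} (f : ℤ → ℤ → ℤ) → f (+ 0) (+ 0) ≡ + 0 → ∀ (u v : Vec ℤ n) k →
                 lk (+ 0) (zipWith f u v) k ≡ f (lk (+ 0) u k) (lk (+ 0) v k)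
    lk-zipWith f f00 [] [] k = sym f00
    lk-zipWith f f00 (x ∷ u) (y ∷ v) zero = refl
    lk-zipWith f f00 (x ∷ u) (y ∷ v) (suc k) = lk-zipWith f f00 u v k

    lk-map : ∀ {A : Set} {d n} (f : A → ℤ) → f d ≡ + 0 → ∀ (v : Vec A n) k → lk (+ 0) (Vec.map f v) k ≡ f (lk d v k)
    lk-map f f0 [] k = sym f0
    lk-map f f0 (x ∷ v) zero = refl
    lk-map f f0 (x ∷ v) (suc k) = lk-map f f0 v k

  ‼ℤ-⊕ : ∀ {N} (u v : Vec ℤ N) l → (u ⊕ v) ‼ℤ l ≡ u ‼ℤ l + v ‼ℤ l
  ‼ℤ-⊕ u v zero = refl
  ‼ℤ-⊕ u v (suc k) = lk-zipWith _+_ refl u v k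

  ‼ℤ-⊖ : ∀ {N} (u v : Vec ℤ N) l → (u ⊖ v) ‼ℤ l ≡ u ‼ℤ l - v ‼ℤ l
  ‼ℤ-⊖ u v zero = refl
  ‼ℤ-⊖ u v (suc k) = lk-zipWith _-_ refl u v k

  ‼ℤ-· : ∀ {N} c (v : Vec ℤ N) l → (c · v) ‼ℤ l ≡ c * v ‼ℤ l
  ‼ℤ-· c v zero = sym (ℤP.*-zeroʳ c)
  ‼ℤ-· c v (suc k) = lk-map (c *_) (ℤP.*-zeroʳ c) v k

  ‼ℤ-toℤ : ∀ {N} (α : Vec ℕ N) l → toℤ α ‼ℤ l ≡ + (α ‼ l)
  ‼ℤ-toℤ α zero = refl
  ‼ℤ-toℤ α (suc k) = lk-map +_ refl α k

  ‼ℤ-replicate : ∀ N l → replicate N (+ 0) ‼ℤ l ≡ + 0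
  ‼ℤ-replicate N zero = refl
  ‼ℤ-replicate N (suc k) = lk-replicate N k
    where
    lk-replicate : ∀ n k → lk (+ 0) (replicate n (+ 0)) k ≡ + 0
    lk-replicate zero k = refl
    lk-replicate (suc n) zero = refl
    lk-replicate (suc n) (suc k) = lk-replicate n k

  ‼ℤ-ε : ∀ {N p l} → InRange N l → ε N p ‼ℤ l ≡ (if l ≡ᵇ p then + 1 else + 0)
  ‼ℤ-ε {suc N} {p} {suc k} (_ , s≤s k<N) = trans (lk-tabulate (λ j → if suc (toℕ j) ≡ᵇ p then + 1 else + 0) k (s≤s k<N))
    (cong (λ i → if suc i ≡ᵇ p then + 1 else + 0) (FinP.toℕ-fromℕ< (s≤s k<N)))
    where
    lk-tabulate : ∀ {n} (g : Fin n → ℤ) k (k<n : k < n) → lk (+ 0) (tabulate g) k ≡ g (fromℕ< k<n)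
    lk-tabulate {suc n} g zero _ = refl
    lk-tabulate {suc n} g (suc k) (s≤s k<n) = lk-tabulate (λ i → g (Fin.suc i)) k k<n

  ‼ℤ-ε-≡ : ∀ {N p} → InRange N p → ε N p ‼ℤ p ≡ + 1
  ‼ℤ-ε-≡ {p = p} p∈ =
    trans (‼ℤ-ε p∈) (cong (λ b → if b then + 1 else + 0) (Equivalence.to T-≡ (ℕP.≡⇒≡ᵇ p p refl)))

  ‼ℤ-ε-≢ : ∀ {N p l} → InRange N l → l ≢ p → ε N p ‼ℤ l ≡ + 0
  ‼ℤ-ε-≢ {p = p} {l} l∈ l≢p =
    trans (‼ℤ-ε l∈) (cong (λ b → if b then + 1 else + 0) (¬T⇒≡false (l≢p ∘ ℕP.≡ᵇ⇒≡ l p)))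

  ‼ℤ-Σ : ∀ {N} (f : ℕ → Vec ℤ N) s l → (Σ[1… s ] f) ‼ℤ l ≡ Σ≤ (λ i → f i ‼ℤ l) s
  ‼ℤ-Σ {N} f s l = ‼ℤ-foldr (positions s)
    where
    ‼ℤ-foldr : ∀ is → List.foldr _⊕_ (replicate N (+ 0)) (List.map f is) ‼ℤ l ≡ sumℤ (List.map (λ i → f i ‼ℤ l) is)
    ‼ℤ-foldr [] = ‼ℤ-replicate N l
    ‼ℤ-foldr (i ∷ is) = trans (‼ℤ-⊕ (f i) _ l) (cong (_+_ (f i ‼ℤ l)) (‼ℤ-foldr is))

  ‼ℤ-extensionality : ∀ {N} (u v : Vec ℤ N) → (∀ l → InRange N l → u ‼ℤ l ≡ v ‼ℤ l) → u ≡ v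
  ‼ℤ-extensionality [] [] _ = refl
  ‼ℤ-extensionality (x ∷ u) (y ∷ v) u≗v = cong₂ _∷_ (u≗v 1 (s≤s z≤n , s≤s z≤n))
    (‼ℤ-extensionality u v (λ { (suc k) (_ , k<N) → u≗v (suc (suc k)) (s≤s z≤n , s≤s k<N) }))


module Chain where
  open import Data.Nat as ℕ using (ℕ; zero; suc; _∸_; _≤_; _<_; s≤s; z≤n; _≟_)
  import Data.Nat.Properties as ℕP
  open import Data.Nat.DivMod using (_%_; _/_; m%n<n; [m+n]%n≡m%n; m/n≡1+[m∸n]/n)
  open import Data.Integer as ℤ using (ℤ; +_; _+_; _-_; _*_)
  import Data.Integer.Properties as ℤP
  open import Data.Integer.Tactic.RingSolver using (solve-∀)
  open import Data.Rational as ℚ using (ℚ)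
  open import Data.Vec using (Vec)
  open import Data.Product using (_×_; _,_; proj₁; proj₂)
  open import Data.Sum using (_⊎_; inj₁; inj₂)
  open import Data.Empty using (⊥-elim)
  open import Function using (_∘_)
  open import Relation.Binary.PropositionalEquality
  open import Relation.Nullary using (yes; no; Dec)
  open AlphaTilde using (αtil<⇒≺)
  open Positions using (InRange; Σ≤; Σ≤-suc)
  open Transfer using (IsTransfer; transfer-⊳)
  open Lookups
  open Ranks using (period; IsRanking; module Ranking; rank-≥1; rank-≤)
  open Residues using (hits; hits-src; hits-suc-src; hits-suc-other; hits-final)

  module Moves {N} {α : Vec ℕ N} {w : ℕ → ℕ} (ranking : IsRanking α w) (n T : ℕ)
               (m+T≤N : period α w n ℕ.+ T ≤ N) where
    open TildeOrder (α ‼_)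
    open Ranking ranking

    m : ℕ
    m = period α w n

    src dst : ℕ → ℕ
    src s = w (suc (s % m))
    dst s = w (m ℕ.+ suc s)

    move : ℕ → Vec ℤ N
    move i = ε N (w (suc ((i ∸ 1) % m))) ⊖ ε N (w (m ℕ.+ i))

    β : ℕ → Vec ℤ N
    β s = toℤ α ⊖ ((+ n) · Σ[1… s ] move)

    moved : ℕ → ℕ → ℤ
    moved s l = (Σ[1… s ] move) ‼ℤ l

    m≤N : m ≤ N
    m≤N = ℕP.≤-trans (ℕP.m≤m+n m T) m+T≤N

    head∈ : ∀ {i} → 1 ≤ i → i ≤ m → InRange N i
    head∈ 1≤i i≤m = 1≤i , ℕP.≤-trans i≤m m≤N

    src-index∈ : ∀ s → InRange N (suc (s % m))
    src-index∈ s = head∈ (s≤s z≤n) (m%n<n s m)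

    dst-index∈ : ∀ {s} → s < T → InRange N (m ℕ.+ suc s)
    dst-index∈ {s} s<T = ℕP.≤-trans (s≤s z≤n) (ℕP.m≤n+m (suc s) m) , ℕP.≤-trans (ℕP.+-monoʳ-≤ m s<T) m+T≤N

    β-‼ : ∀ s l → β s ‼ℤ l ≡ + (α ‼ l) - + n * moved s l
    β-‼ s l = trans (‼ℤ-⊖ (toℤ α) _ l) (cong₂ _-_ (‼ℤ-toℤ α l) (‼ℤ-· (+ n) _ l))

    moved-suc : ∀ s l → moved (suc s) l ≡ moved s l + (ε N (src s) ‼ℤ l - ε N (dst s) ‼ℤ l)
    moved-suc s l = begin
      moved (suc s) l                                   ≡⟨ ‼ℤ-Σ move (suc s) l ⟩
      Σ≤ (λ i → move i ‼ℤ l) (suc s)                    ≡⟨ Σ≤-suc (λ i → move i ‼ℤ l) s ⟩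
      Σ≤ (λ i → move i ‼ℤ l) s + move (suc s) ‼ℤ l      ≡⟨ cong₂ _+_ (sym (‼ℤ-Σ move s l)) (‼ℤ-⊖ _ _ l) ⟩
      moved s l + (ε N (src s) ‼ℤ l - ε N (dst s) ‼ℤ l) ∎
      where open ≡-Reasoning

    moved-step : ∀ {s l a b c} → moved s l ≡ a → ε N (src s) ‼ℤ l ≡ b → ε N (dst s) ‼ℤ l ≡ c →
                 moved (suc s) l ≡ a + (b - c)
    moved-step {s} {l} ma eb ec = trans (moved-suc s l) (cong₂ _+_ ma (cong₂ _-_ eb ec))

    moved-zero : ∀ l → moved 0 l ≡ + 0
    moved-zero l = ‼ℤ-replicate N l

    ε-w-≡ : ∀ {i} → InRange N i → ε N (w i) ‼ℤ w i ≡ + 1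
    ε-w-≡ i∈ = ‼ℤ-ε-≡ (w-inRange i∈)

    ε-w-≢ : ∀ {i j} → InRange N i → InRange N j → i ≢ j → ε N (w j) ‼ℤ w i ≡ + 0
    ε-w-≢ i∈ j∈ i≢j = ‼ℤ-ε-≢ (w-inRange i∈) (i≢j ∘ w-injective i∈ j∈)

    moved-head : ∀ s → s ≤ T → ∀ {i} → 1 ≤ i → i ≤ m → moved s (w i) ≡ + hits m s i
    moved-head zero _ {suc i} _ _ = moved-zero (w (suc i))
    moved-head (suc s) s<T {i} 1≤i i≤m = step (i ≟ suc (s % m))
      where
      i∈ = head∈ 1≤i i≤m
      ih = moved-head s (ℕP.<⇒≤ s<T) 1≤i i≤m
      at-dst = ε-w-≢ i∈ (dst-index∈ s<T) (ℕP.<⇒≢ (ℕP.≤-<-trans i≤m (ℕP.m<m+n m (s≤s z≤n))))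
      step : Dec (i ≡ suc (s % m)) → moved (suc s) (w i) ≡ + hits m (suc s) i
      step (yes refl) = trans (moved-step {s} {w i} ih (ε-w-≡ i∈) at-dst)
                              (trans (ℤP.+-comm (+ hits m s i) (+ 1)) (cong +_ (sym (hits-suc-src m s))))
      step (no i≢src) = trans (moved-step {s} {w i} ih (ε-w-≢ i∈ (src-index∈ s) i≢src) at-dst)
                              (trans (ℤP.+-identityʳ _) (cong +_ (sym (hits-suc-other m s 1≤i i≤m i≢src))))

    moved-rest : ∀ s → s ≤ T → ∀ {i} → m ℕ.+ s < i → i ≤ N → moved s (w i) ≡ + 0
    moved-rest zero _ {i} _ _ = moved-zero (w i)
    moved-rest (suc s) s<T {i} m+s<i i≤N =
      moved-step {s} {w i} (moved-rest s (ℕP.<⇒≤ s<T) (ℕP.<-trans (ℕP.+-monoʳ-< m (ℕP.n<1+n s)) m+s<i) i≤N)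
        (ε-w-≢ i∈ (src-index∈ s) (ℕP.>⇒≢ (ℕP.≤-<-trans (m%n<n s m) m<i)))
        (ε-w-≢ i∈ (dst-index∈ s<T) (ℕP.>⇒≢ m+s<i))
      where
      m<i = ℕP.≤-<-trans (ℕP.m≤m+n m (suc s)) m+s<i
      i∈ = ℕP.≤-trans (s≤s z≤n) m<i , i≤N

    moved-tail : ∀ s → s ≤ T → ∀ {i} → m < i → i ≤ m ℕ.+ s → moved s (w i) ≡ ℤ.- + 1
    moved-tail zero _ {i} m<i i≤m+0 = ⊥-elim (ℕP.<⇒≱ m<i (subst (i ≤_) (ℕP.+-identityʳ m) i≤m+0))
    moved-tail (suc s) s<T {i} m<i i≤m+s+1 = step (i ≟ m ℕ.+ suc s)
      where
      i∈ = ℕP.≤-trans (s≤s z≤n) m<i , ℕP.≤-trans i≤m+s+1 (proj₂ (dst-index∈ s<T))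
      at-src = ε-w-≢ i∈ (src-index∈ s) (ℕP.>⇒≢ (ℕP.≤-<-trans (m%n<n s m) m<i))
      step : Dec (i ≡ m ℕ.+ suc s) → moved (suc s) (w i) ≡ ℤ.- + 1
      step (yes refl) = moved-step {s} {w i}
        (moved-rest s (ℕP.<⇒≤ s<T) (ℕP.+-monoʳ-< m (ℕP.n<1+n s)) (proj₂ i∈)) at-src (ε-w-≡ i∈)
      step (no i≢dst) = moved-step {s} {w i}
        (moved-tail s (ℕP.<⇒≤ s<T) m<i (ℕP.≤-pred (subst (i <_) (ℕP.+-suc m s) (ℕP.≤∧≢⇒< i≤m+s+1 i≢dst))))
        at-src (ε-w-≢ i∈ (dst-index∈ s<T) i≢dst)

    β-‼-moved : ∀ s l {c} → moved s l ≡ c → β s ‼ℤ l ≡ + (α ‼ l) - + n * c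
    β-‼-moved s l eq = trans (β-‼ s l) (cong (λ c → + (α ‼ l) - + n * c) eq)

    β-suc : ∀ s l → β (suc s) ‼ℤ l ≡ β s ‼ℤ l - + n * (ε N (src s) ‼ℤ l - ε N (dst s) ‼ℤ l)
    β-suc s l = trans (β-‼-moved (suc s) l (moved-suc s l))
      (trans (distrib (+ (α ‼ l)) (+ n) (moved s l) d) (cong (_- + n * d) (sym (β-‼ s l))))
      where
      d = ε N (src s) ‼ℤ l - ε N (dst s) ‼ℤ l
      distrib : ∀ a n c d → a - n * (c + d) ≡ a - n * c - n * d
      distrib = solve-∀

    β-suc-at : ∀ s l {e₁ e₂} → ε N (src s) ‼ℤ l ≡ e₁ → ε N (dst s) ‼ℤ l ≡ e₂ →
               β (suc s) ‼ℤ l ≡ β s ‼ℤ l - + n * (e₁ - e₂)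
    β-suc-at s l eq₁ eq₂ = trans (β-suc s l) (cong (λ d → β s ‼ℤ l - + n * d) (cong₂ _-_ eq₁ eq₂))

    src<dst : ∀ s → suc (s % m) < m ℕ.+ suc s
    src<dst s = ℕP.≤-<-trans (m%n<n s m) (ℕP.m<m+n m (s≤s z≤n))

    step-transfer : ∀ s → s < T → IsTransfer (β s) (β (suc s)) (src s) (dst s) n
    step-transfer s s<T = record
      { p∈ = p∈
      ; q∈ = q∈
      ; p≢q = p≢q
      ; at-p = trans (β-suc-at s (src s) (‼ℤ-ε-≡ p∈) (‼ℤ-ε-≢ p∈ p≢q)) (minus (β s ‼ℤ src s) (+ n))
      ; at-q = trans (β-suc-at s (dst s) (‼ℤ-ε-≢ q∈ (p≢q ∘ sym)) (‼ℤ-ε-≡ q∈)) (plus (β s ‼ℤ dst s) (+ n))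
      ; elsewhere = λ l l∈ l≢p l≢q →
          trans (β-suc-at s l (‼ℤ-ε-≢ l∈ l≢p) (‼ℤ-ε-≢ l∈ l≢q)) (unchanged (β s ‼ℤ l) (+ n))
      }
      where
      p∈ = w-inRange (src-index∈ s)
      q∈ = w-inRange (dst-index∈ s<T)
      p≢q : src s ≢ dst s
      p≢q = ℕP.<⇒≢ (src<dst s) ∘ w-injective (src-index∈ s) (dst-index∈ s<T)
      minus : ∀ x n → x - n * (+ 1 - + 0) ≡ x - n
      minus = solve-∀
      plus : ∀ x n → x - n * (+ 0 - + 1) ≡ x + n
      plus = solve-∀
      unchanged : ∀ x n → x - n * (+ 0 - + 0) ≡ x
      unchanged = solve-∀

    ξ : ℕ → ℚ
    ξ j = αtil α (w (suc ((j ∸ 1) % m))) ℚ.- ((+ n ℚ./ 1) ℚ.* (+ ((j ∸ 1) / m) ℚ./ 1))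

    BelowξUntilT : Set
    BelowξUntilT = ∀ s → 1 ≤ s → s < T → αtil α (w (m ℕ.+ s)) ℚ.< ξ (m ℕ.+ s ℕ.+ 1)

    gap : BelowξUntilT → ∀ s → s < T → dst s ≺⟨ n ℕ.* suc (s / m) ⟩ src s
    gap _ zero 0<T = subst (λ d → dst 0 ≺⟨ d ⟩ src 0) (sym (ℕP.*-identityʳ n)) (leg-gap n (proj₂ (dst-index∈ 0<T)))
    gap below (suc s₀) s<T = ≼-≺-trans (≺⇒≼ dst≺previous) previous-below-src
      where
      s = suc s₀
      m+s∈ : InRange N (m ℕ.+ s)
      m+s∈ = ℕP.≤-trans (s≤s z≤n) (ℕP.m≤n+m s m) , ℕP.≤-trans (ℕP.+-monoʳ-≤ m (ℕP.<⇒≤ s<T)) m+T≤N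
      dst≺previous : dst s ≺ w (m ℕ.+ s)
      dst≺previous = w-antitone (proj₁ m+s∈) (ℕP.+-monoʳ-< m (ℕP.n<1+n s)) (proj₂ (dst-index∈ s<T))
      index : m ℕ.+ s ℕ.+ 1 ∸ 1 ≡ m ℕ.+ s
      index = ℕP.m+n∸n≡m (m ℕ.+ s) 1
      remainder : (m ℕ.+ s) % m ≡ s % m
      remainder = trans (cong (_% m) (ℕP.+-comm m s)) ([m+n]%n≡m%n s m)
      quotient : (m ℕ.+ s) / m ≡ suc (s / m)
      quotient = trans (m/n≡1+[m∸n]/n (ℕP.m≤m+n m s)) (cong (λ z → suc (z / m)) (ℕP.m+n∸m≡n m s))
      previous-below-src : w (m ℕ.+ s) ≺⟨ n ℕ.* suc (s / m) ⟩ src s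
      previous-below-src = subst₂ (λ r q → w (m ℕ.+ s) ≺⟨ n ℕ.* q ⟩ w (suc r)) remainder quotient
        (subst (λ j → w (m ℕ.+ s) ≺⟨ n ℕ.* (j / m) ⟩ w (suc (j % m))) index
          (αtil<⇒≺ α n _ (proj₂ (w-inRange m+s∈)) (below s (s≤s z≤n) s<T)))

    private
      transpose-< : ∀ x {y z} → x + y ℤ.< z → y ℤ.< z - x
      transpose-< x {y} {z} lt = subst (ℤ._< z - x) (cancel x y) (ℤP.+-monoˡ-< (ℤ.- x) lt)
        where
        cancel : ∀ x y → x + y - x ≡ y
        cancel = solve-∀

      transpose-≡ : ∀ x {y z} → x + y ≡ z → y ≡ z - x
      transpose-≡ x {y} {z} eq = trans (sym (cancel x y)) (cong (_- x) eq)
        where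
        cancel : ∀ x y → x + y - x ≡ y
        cancel = solve-∀

      ℕ→ℤ : ∀ k a → + (n ℕ.* suc k ℕ.+ a) ≡ + n * + k + (+ a + + n)
      ℕ→ℤ k a = trans (ℤP.pos-+ (n ℕ.* suc k) a)
        (trans (cong (_+ + a) (trans (ℤP.pos-* n (suc k)) (cong (+ n *_) (ℤP.pos-+ 1 k)))) (regroup (+ n) (+ k) (+ a)))
        where
        regroup : ∀ n k a → n * (+ 1 + k) + a ≡ n * k + (a + n)
        regroup = solve-∀

    β-at-src : ∀ s → s ≤ T → β s ‼ℤ src s ≡ + (α ‼ src s) - + n * + (s / m)
    β-at-src s s≤T = β-‼-moved s (src s) (trans (moved-head s s≤T (s≤s z≤n) (m%n<n s m)) (cong +_ (hits-src m s)))

    β-at-dst : ∀ s → s < T → β s ‼ℤ dst s ≡ + (α ‼ dst s)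
    β-at-dst s s<T = trans (β-‼-moved s (dst s) untouched-so-far) (untouched (+ (α ‼ dst s)) (+ n))
      where
      untouched-so-far = moved-rest s (ℕP.<⇒≤ s<T) (ℕP.+-monoʳ-< m (ℕP.n<1+n s)) (proj₂ (dst-index∈ s<T))
      untouched : ∀ a n → a - n * + 0 ≡ a
      untouched = solve-∀

    transfer-condition : BelowξUntilT → ∀ s → s < T →
      β s ‼ℤ dst s + + n ℤ.< β s ‼ℤ src s ⊎ (β s ‼ℤ dst s + + n ≡ β s ‼ℤ src s × src s < dst s)
    transfer-condition below s s<T with gap below s s<T
    ... | inj₁ lt = inj₁ (subst₂ (λ x y → x + + n ℤ.< y) (sym at-dst) (sym at-src)
                      (transpose-< (+ n * + (s / m)) (subst (ℤ._< + (α ‼ src s)) (ℕ→ℤ (s / m) (α ‼ dst s)) (ℤ.+<+ lt))))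
      where
      at-src = β-at-src s (ℕP.<⇒≤ s<T)
      at-dst = β-at-dst s s<T
    ... | inj₂ (eq , src<dst) = inj₂ (subst₂ (λ x y → x + + n ≡ y) (sym at-dst) (sym at-src)
                      (transpose-≡ (+ n * + (s / m)) (trans (sym (ℕ→ℤ (s / m) (α ‼ dst s))) (cong +_ eq))) , src<dst)
      where
      at-src = β-at-src s (ℕP.<⇒≤ s<T)
      at-dst = β-at-dst s s<T

    step-⊳ : BelowξUntilT → 1 ≤ n → ∀ s → s < T → β s ⊳ β (suc s)
    step-⊳ below 1≤n s s<T = transfer-⊳ (step-transfer s s<T) 1≤n (transfer-condition below s s<T)

    β-zero : β 0 ≡ toℤ α
    β-zero = ‼ℤ-extensionality (β 0) (toℤ α) λ l _ →
      trans (β-‼-moved 0 l (moved-zero l)) (trans (untouched (+ (α ‼ l)) (+ n)) (sym (‼ℤ-toℤ α l)))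
      where
      untouched : ∀ a n → a - n * + 0 ≡ a
      untouched = solve-∀

    module _ (1≤T : 1 ≤ T) (β′ : Vec ℤ N) where
      private
        t = suc ((T ∸ 1) % m)
        k = (T ∸ t) / m

      β-final : (∀ i → 1 ≤ i → i ≤ t → β′ ‼ℤ w i ≡ + (α ‼ w i) - + ((k ℕ.+ 1) ℕ.* n)) →
                (∀ i → t < i → i ≤ m → β′ ‼ℤ w i ≡ + (α ‼ w i) - + (k ℕ.* n)) →
                (∀ i → m ℕ.+ 1 ≤ i → i ≤ m ℕ.+ T → β′ ‼ℤ w i ≡ + (α ‼ w i) + + n) →
                (∀ i → m ℕ.+ T < i → i ≤ N → β′ ‼ℤ w i ≡ + (α ‼ w i)) →
                β T ≡ β′
      β-final first-t rest-of-head tail untouched = ‼ℤ-extensionality (β T) β′ λ l l∈ →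
        subst (λ l → β T ‼ℤ l ≡ β′ ‼ℤ l) (w-rank l∈) (at-w (rank α l) (rank-≥1 α l∈) (rank-≤ α l))
        where
        scale : ∀ c → + n * + c ≡ + (c ℕ.* n)
        scale c = trans (sym (ℤP.pos-* n c)) (cong +_ (ℕP.*-comm n c))
        at-w : ∀ i → 1 ≤ i → i ≤ N → β T ‼ℤ w i ≡ β′ ‼ℤ w i
        at-w i 1≤i i≤N with i ℕ.≤? m
        ... | yes i≤m with i ℕ.≤? t
        ...   | yes i≤t = trans (β-‼-moved T (w i) (trans head (cong +_ (proj₁ (hits-final m 1≤T 1≤i i≤m) i≤t))))
                            (trans (cong (+ (α ‼ w i) -_) (scale (k ℕ.+ 1))) (sym (first-t i 1≤i i≤t)))
          where head = moved-head T ℕP.≤-refl 1≤i i≤m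
        ...   | no i≰t = trans (β-‼-moved T (w i) (trans head (cong +_ (proj₂ (hits-final m 1≤T 1≤i i≤m) t<i))))
                            (trans (cong (+ (α ‼ w i) -_) (scale k)) (sym (rest-of-head i t<i i≤m)))
          where head = moved-head T ℕP.≤-refl 1≤i i≤m
                t<i = ℕP.≰⇒> i≰t
        at-w i 1≤i i≤N | no i≰m with i ℕ.≤? m ℕ.+ T
        ...   | yes i≤m+T = trans (β-‼-moved T (w i) (moved-tail T ℕP.≤-refl (ℕP.≰⇒> i≰m) i≤m+T))
                              (trans (returned (+ (α ‼ w i)) (+ n)) (sym (tail i m+1≤i i≤m+T)))
          where
          m+1≤i = subst (_≤ i) (ℕP.+-comm 1 m) (ℕP.≰⇒> i≰m)
          returned : ∀ a n → a - n * ℤ.- + 1 ≡ a + n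
          returned = solve-∀
        ...   | no i≰m+T = trans (β-‼-moved T (w i) (moved-rest T ℕP.≤-refl (ℕP.≰⇒> i≰m+T) i≤N))
                              (trans (unmoved (+ (α ‼ w i)) (+ n)) (sym (untouched i (ℕP.≰⇒> i≰m+T) i≤N)))
          where
          unmoved : ∀ a n → a - n * + 0 ≡ a
          unmoved = solve-∀

open import Data.Nat using (ℕ; suc; _+_; _*_; _∸_; _≤_; _<_)
open import Data.Nat.DivMod using (_%_; _/_)
open import Data.Integer using (ℤ; +_) renaming (_-_ to _-ℤ_; _+_ to _+ℤ_)
open import Data.Rational using (ℚ) renaming (_/_ to _/ℚ_; _-_ to _-ℚ_; _*_ to _*ℚ_; _<_ to _<ℚ_; _>_ to _>ℚ_)
open import Data.Vec using (Vec)
open import Data.Product using (_×_; _,_)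
open import Relation.Binary.PropositionalEquality using (_≡_)

mainTheorem7 :
  ∀ {N : ℕ} (α : Vec ℕ N) → N ≡ ℓ α + ∣ α ∣ →
  (w : ℕ → ℕ) →
  (∀ i → 1 ≤ i → i ≤ N → (1 ≤ w i) × (w i ≤ N) × (rank α (w i) ≡ i)) →
  (n : ℕ) → 1 ≤ n → n ≤ α ‼ w 1 →
  let m = suc (leg α (w 1) (suc (α ‼ w 1) ∸ n))
      ξ = λ (j : ℕ) → αtil α (w (suc ((j ∸ 1) % m))) -ℚ ((+ n /ℚ 1) *ℚ (+ ((j ∸ 1) / m) /ℚ 1))
  in
  (T : ℕ) → 1 ≤ T → m + T ≤ N →
  (∀ s → 1 ≤ s → s < T → αtil α (w (m + s)) <ℚ ξ (m + s + 1)) →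
  αtil α (w (m + T)) >ℚ ξ (m + T + 1) →
  let t = suc ((T ∸ 1) % m)
      k = (T ∸ t) / m
      βs = λ (s : ℕ) → toℤ α ⊖ ((+ n) · Σ[1… s ] (λ i → ε N (w (suc ((i ∸ 1) % m))) ⊖ ε N (w (m + i))))
  in
  (β : Vec ℤ N) →
  (∀ i → 1 ≤ i → i ≤ t → β ‼ℤ w i ≡ + (α ‼ w i) -ℤ + ((k + 1) * n)) →
  (∀ i → t < i → i ≤ m → β ‼ℤ w i ≡ + (α ‼ w i) -ℤ + (k * n)) →
  (∀ i → m + 1 ≤ i → i ≤ m + T → β ‼ℤ w i ≡ + (α ‼ w i) +ℤ + n) →
  (∀ i → m + T < i → i ≤ N → β ‼ℤ w i ≡ + (α ‼ w i)) →
  (βs 0 ≡ toℤ α) × (βs T ≡ β) × (∀ s → s < T → βs s ⊳ βs (suc s))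
mainTheorem7 α _ w ranking n 1≤n _ T 1≤T m+T≤N below-ξ _ β′ first-t rest-of-head tail untouched =
  β-zero , β-final 1≤T β′ first-t rest-of-head tail untouched , step-⊳ below-ξ 1≤n
  where open Chain.Moves ranking n T m+T≤N
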